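{- Let $m\ge2$. With $Z_m$, $G$, $H$ and $T_1,\dots,T_6$ as in the context, \begin{align*} T_1(x)&=Z_m(x),\qquad T_2(x)=\frac{1-x^{m-2}}{1-x}+x^{m-2}G(x),\\ T_3(x)&=\frac{x^{m-2}(1-x^{m-2})}{1-x}+x^{2m-4}H(x),\qquad T_4(x)=\frac{1-x^{m-1}}{1-x}+x^{m-1}Z_m(x),\\ T_5(x)&=\frac{x^{m-1}(1-x^{m-2})}{1-x}+x^{2m-3}G(x),\qquad T_6(x)=\frac{x^{m-1}(1-x^{m-1})}{1-x}+x^{2m-2}Z_m(x). \end{align*}
   Context: $[n]=\{1,\dots,n\}$. A diagram is a simple graph on vertices placed in increasing order on a line; edge $\{i,j\}$, $i<j$, is an arc $(i,j)$; arcs $(i_1,j_1),(i_2,j_2)$ cross if $i_1<i_2<j_1<j_2$; a stack has no crossing arcs. $\mathrm{ld}(v)$ (resp. $\mathrm{rd}(v)$) is the number of arcs $(i,v)$, $i<v$ (resp. $(v,j)$, $j>v$), $\deg=\mathrm{ld}+\mathrm{rd}$. A zigzag stack is a stack with all degrees $\le2$ and no vertex with both $\mathrm{ld}>0$ and $\mathrm{rd}>0$. A zigzag stack on $[n]$ is $m$-reduced if $\mathrm{ld}(i)+\mathrm{rd}(i+m-1)\le2$ for $1\le i\le n-m+1$, and $j-i\ge m-1$ whenever $1\le i<j\le n$, $\mathrm{ld}(i)>0$, $\mathrm{rd}(j)>0$. $z_m(n)$: number of $m$-reduced zigzag stacks on $[n]$, $z_m(0)=1$, $Z_m(x)=\sum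 z_m(n)x^n$. $g(n)$ (resp. $h(n)$): number of $m$-reduced zigzag stacks on $[n]$ with $\deg(1)\le1$ (resp. $\deg(1)\le1$ and $\deg(n)\le1$) for $n\ge1$, $g(0)=h(0)=1$; $G(x)=\sum g(n)x^n$, $H(x)=\sum h(n)x^n$. Boundary types: for $a,b\in\{0,1,2\}$, an $m$-reduced zigzag stack $T$ on $[\ell]$ ($\ell\ge0$) is of type $(a,b)$ if, on vertex set $\{0,\dots,\ell+1\}$ with $\lambda(0)=a,\rho(0)=0$, $\lambda(k)=\mathrm{ld}_T(k),\rho(k)=\mathrm{rd}_T(k)$ ($1\le k\le\ell$), $\lambda(\ell+1)=0,\rho(\ell+1)=b$: (i) $\lambda(i)+\rho(i+m-1)\le2$ for all $0\le i\le\ell+2-m$; (ii) $j-i\ge m-1$ for all $0\le i<j\le\ell+1$ with $\lambda(i)>0,\rho(j)>0$. $T_1=(0,0)$, $T_2=(1,0)$, $T_3=(1,1)$, $T_4=(2,0)$, $T_5=(2,1)$, $T_6=(2,2)$; $t_i(n)$ counts $m$-reduced zigzag stacks on $[n]$ of type $T_i$, $T_i(x)=\sum_{n\ge0}t_i(n)x^n$. -}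

module Defs where

open import Data.Bool.Base using (Bool; true; false; _∧_; _∨_; not; if_then_else_)
open import Data.Nat.Base using (ℕ; zero; suc; _+_; _∸_; _<ᵇ_; _≤ᵇ_; _≡ᵇ_)
open import Data.Integer.Base as ℤ using (ℤ; +_)
open import Data.List.Base using (List; []; _∷_; _++_; map; filter; length; concatMap; upTo; sum)
open import Data.Product.Base using (_×_; _,_; proj₁; proj₂)
open import Relation.Binary.PropositionalEquality using (_≡_)
open import Data.Bool.Properties using (T?)

-- Diagrams on [n] = {1,…,n}: a diagram is a set of arcs (i , j) with
-- 1 ≤ i < j ≤ n, represented as a sublist of the canonical list of all
-- such arcs (so every diagram occurs exactly once in `diagrams n`).

all : {A : Set} → (A → Bool) → List A → Bool
all p [] = true
all p (x ∷ xs) = p x ∧ all p xs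

Arc : Set
Arc = ℕ × ℕ

Diagram : Set
Diagram = List Arc

range1 : ℕ → List ℕ
range1 n = map suc (upTo n)

allArcs : ℕ → List Arc
allArcs n = concatMap (λ i → map (λ j → (i , j)) (filter (λ j → T? (i <ᵇ j)) (range1 n))) (range1 n)

sublists : {A : Set} → List A → List (List A)
sublists [] = [] ∷ []
sublists (x ∷ xs) = sublists xs ++ map (x ∷_) (sublists xs)

diagrams : ℕ → List Diagram
diagrams n = sublists (allArcs n)

ld : Diagram → ℕ → ℕ
ld D v = length (filter (λ a → T? (proj₂ a ≡ᵇ v)) D)

rd : Diagram → ℕ → ℕ
rd D v = length (filter (λ a → T? (proj₁ a ≡ᵇ v)) D)

deg : Diagram → ℕ → ℕ
deg D v = ld D v + rd D v

crossB : Arc → Arc → Bool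
crossB (i₁ , j₁) (i₂ , j₂) = (i₁ <ᵇ i₂) ∧ (i₂ <ᵇ j₁) ∧ (j₁ <ᵇ j₂)

isStack : Diagram → Bool
isStack D = all (λ a → all (λ b → not (crossB a b)) D) D

isZigzag : ℕ → Diagram → Bool
isZigzag n D = isStack D ∧
  all (λ v → (deg D v ≤ᵇ 2) ∧ not ((0 <ᵇ ld D v) ∧ (0 <ᵇ rd D v))) (range1 n)

isReduced : ℕ → ℕ → Diagram → Bool
isReduced m n D =
  all (λ i → if (i + m ∸ 1) ≤ᵇ n then (ld D i + rd D (i + m ∸ 1)) ≤ᵇ 2 else true) (range1 n) ∧
  all (λ i → all (λ j → if (i <ᵇ j) ∧ (0 <ᵇ ld D i) ∧ (0 <ᵇ rd D j)
                        then (m ∸ 1) ≤ᵇ (j ∸ i) else true) (range1 n)) (range1 n)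

isRZ : ℕ → ℕ → Diagram → Bool
isRZ m n D = isZigzag n D ∧ isReduced m n D

count : ℕ → (Diagram → Bool) → ℕ
count n P = length (filter (λ D → T? (P D)) (diagrams n))

z : ℕ → ℕ → ℕ
z m zero = 1
z m (suc n) = count (suc n) (isRZ m (suc n))

g : ℕ → ℕ → ℕ
g m zero = 1
g m (suc n) = count (suc n) (λ D → isRZ m (suc n) D ∧ (deg D 1 ≤ᵇ 1))

h : ℕ → ℕ → ℕ
h m zero = 1
h m (suc n) = count (suc n) (λ D → isRZ m (suc n) D ∧ (deg D 1 ≤ᵇ 1) ∧ (deg D (suc n) ≤ᵇ 1))

-- boundary type (a , b) of an m-reduced zigzag stack D on [ℓ],
-- via the extended vertex set {0,…,ℓ+1}
λext : ℕ → ℕ → Diagram → ℕ → ℕ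
λext a ℓ D k = if k ≡ᵇ 0 then a else if k ≡ᵇ suc ℓ then 0 else ld D k

ρext : ℕ → ℕ → Diagram → ℕ → ℕ
ρext b ℓ D k = if k ≡ᵇ 0 then 0 else if k ≡ᵇ suc ℓ then b else rd D k

hasType : ℕ → ℕ → ℕ → ℕ → Diagram → Bool
hasType m a b ℓ D =
  -- (i) for 0 ≤ i ≤ ℓ+2-m, i.e. i ∈ {0,…,ℓ+1} with i+m-1 ≤ ℓ+1
  all (λ i → if (i + m ∸ 1) ≤ᵇ suc ℓ
             then (λext a ℓ D i + ρext b ℓ D (i + m ∸ 1)) ≤ᵇ 2 else true) (upTo (suc (suc ℓ))) ∧
  all (λ i → all (λ j → if (i <ᵇ j) ∧ (0 <ᵇ λext a ℓ D i) ∧ (0 <ᵇ ρext b ℓ D j)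
                        then (m ∸ 1) ≤ᵇ (j ∸ i) else true)
                 (upTo (suc (suc ℓ)))) (upTo (suc (suc ℓ)))

t : ℕ → ℕ → ℕ → ℕ → ℕ
t m a b n = count n (λ D → isRZ m n D ∧ hasType m a b n D)

FPS : Set
FPS = ℕ → ℤ

series : (ℕ → ℕ) → FPS
series f n = + f n

_⊕_ : FPS → FPS → FPS
(F ⊕ G) n = F n ℤ.+ G n

_⊖_ : FPS → FPS → FPS
(F ⊖ G) n = F n ℤ.- G n

sumℤ : List ℤ → ℤ
sumℤ [] = + 0
sumℤ (x ∷ xs) = x ℤ.+ sumℤ xs

_⊛_ : FPS → FPS → FPS
(F ⊛ G) n = sumℤ (map (λ k → F k ℤ.* G (n ∸ k)) (upTo (suc n)))

infixl 6 _⊕_ _⊖_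
infixl 7 _⊛_

one : FPS
one zero = + 1
one (suc n) = + 0

X^ : ℕ → FPS
X^ k n = if n ≡ᵇ k then + 1 else + 0

-- 1/(1-x) = Σ_{n≥0} xⁿ, the multiplicative inverse of 1 - x
inv1-X : FPS
inv1-X n = + 1

_≐_ : FPS → FPS → Set
F ≐ G = ∀ n → F n ≡ G n

infix 4 _≐_

Zser Gser Hser : ℕ → FPS
Zser m = series (z m)
Gser m = series (g m)
Hser m = series (h m)

-- T_i(x), with T₁=(0,0), T₂=(1,0), T₃=(1,1), T₄=(2,0), T₅=(2,1), T₆=(2,2)
Tser : ℕ → ℕ → ℕ → FPS
Tser m a b = series (t m a b)

-- A stack of type (a , b) on [n] has all its arcs strictly inside the window that omits the first k and
-- the last r vertices, where k is 0, m - 2 or m - 1 according as a is 0, 1 or 2, and r likewise for b: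
-- condition (ii) keeps arcs away from the boundary vertices 0 and n + 1, and for degree 2 condition (i)
-- also empties vertex m - 1 (resp. n + 2 - m). Deleting the empty boundary vertices is a bijection onto
-- the m-reduced zigzag stacks on [n - k - r] subject to deg ≤ 1 at each end whose boundary degree is 1;
-- reflecting [n] moves the condition of type (2 , 1) to the first vertex, so that case is counted by G.
-- This accounts for the term x^(k + r) Z, G or H. For n < k + r only the empty stack is left, and whether
-- it has the type is a condition on n alone, which gives the polynomial part.

module Submission where

open import Defs
open import Data.Bool.Base using (Bool; true; false; T; _∧_; not; if_then_else_)
open import Data.Bool.Properties using (T?; ∧-identityʳ)
open import Data.Empty using (⊥-elim)
open import Data.List.Base using (List; []; _∷_; _++_; map; filter; length; upTo)
open import Data.List.Membership.Propositional using (_∈_)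
open import Data.List.Membership.Propositional.Properties
  using (∈-map⁺; ∈-map⁻; ∈-upTo⁺; ∈-upTo⁻; ∈-filter⁺; ∈-filter⁻; ∈-concat⁺′; ∈-concat⁻′)
open import Data.List.Membership.Propositional.Properties.WithK using (unique∧set⇒bag)
open import Data.List.Relation.Binary.BagAndSetEquality using (∼bag⇒↭)
open import Data.List.Relation.Binary.Disjoint.Propositional using (Disjoint)
open import Data.List.Relation.Binary.Permutation.Propositional
  using (_↭_; prep; swap; ↭-sym) renaming (refl to ↭-refl; trans to ↭-trans)
open import Data.List.Relation.Binary.Permutation.Propositional.Properties using (∈-resp-↭)
open import Data.List.Relation.Unary.All as All using (All; []; _∷_)
import Data.List.Relation.Unary.All.Properties as Allₚ
import Data.List.Properties as Listₚ
open import Data.List.Relation.Unary.AllPairs as AllPairs using ([]; _∷_)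
import Data.List.Relation.Unary.AllPairs.Properties as AllPairsₚ
open import Data.List.Relation.Unary.Any using (here; there)
open import Data.List.Relation.Unary.Unique.Propositional using (Unique)
import Data.List.Relation.Unary.Unique.Propositional.Properties as Uniqueₚ
import Data.Integer.Base as ℤ
open import Data.Nat.Base using (ℕ; zero; suc; _+_; _∸_; _*_; _≤_; _<_; _<ᵇ_; _≤ᵇ_; _≡ᵇ_; z≤n; s≤s)
open import Data.Nat.Properties
open import Algebra.Properties.CommutativeSemigroup +-commutativeSemigroup using (interchange; x∙yz≈y∙xz; xy∙z≈xz∙y)
open import Data.Product.Base using (Σ; _×_; _,_; proj₁; proj₂)
open import Data.Sum.Base using (_⊎_; inj₁; inj₂; [_,_]′)
open import Data.Unit.Base using (tt)
open import Function.Bundles using (mk⇔)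
open import Relation.Nullary using (yes; no; ¬_)
open import Relation.Binary.PropositionalEquality

T-∧⁺ : ∀ {a b} → T a → T b → T (a ∧ b)
T-∧⁺ {true} {true} _ _ = tt

T-∧⁻ˡ : ∀ {a b} → T (a ∧ b) → T a
T-∧⁻ˡ {true} _ = tt

T-∧⁻ʳ : ∀ {a b} → T (a ∧ b) → T b
T-∧⁻ʳ {true} t = t

T-not⁺ : ∀ {a} → ¬ T a → T (not a)
T-not⁺ {false} _ = tt
T-not⁺ {true} f = f tt

T-not⁻ : ∀ {a} → T (not a) → ¬ T a
T-not⁻ {false} _ ()

T-if⁺ : ∀ {c e} → (T c → T e) → T (if c then e else true)
T-if⁺ {false} _ = tt
T-if⁺ {true} f = f tt

T-if⁻ : ∀ {c e} → T (if c then e else true) → T c → T e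
T-if⁻ {true} t _ = t

T-ext : ∀ {a b} → (T a → T b) → (T b → T a) → a ≡ b
T-ext {false} {false} _ _ = refl
T-ext {false} {true} _ g = ⊥-elim (g tt)
T-ext {true} {false} f _ = ⊥-elim (f tt)
T-ext {true} {true} _ _ = refl

T⇒≡true : ∀ {b} → T b → b ≡ true
T⇒≡true {true} _ = refl

¬T⇒≡false : ∀ {b} → ¬ T b → b ≡ false
¬T⇒≡false {false} _ = refl
¬T⇒≡false {true} f = ⊥-elim (f tt)

≤ᵇ⁺ : ∀ {a b} → a ≤ b → T (a ≤ᵇ b)
≤ᵇ⁺ = ≤⇒≤ᵇ

≤ᵇ⁻ : ∀ {a b} → T (a ≤ᵇ b) → a ≤ b
≤ᵇ⁻ {a} {b} = ≤ᵇ⇒≤ a b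

<ᵇ⁺ : ∀ {a b} → a < b → T (a <ᵇ b)
<ᵇ⁺ = <⇒<ᵇ

<ᵇ⁻ : ∀ {a b} → T (a <ᵇ b) → a < b
<ᵇ⁻ {a} {b} = <ᵇ⇒< a b

≡ᵇ-refl : ∀ x → (x ≡ᵇ x) ≡ true
≡ᵇ-refl x = T⇒≡true (≡⇒≡ᵇ x x refl)

≢⇒≡ᵇ-false : ∀ {x y} → x ≢ y → (x ≡ᵇ y) ≡ false
≢⇒≡ᵇ-false {x} {y} x≢y = ¬T⇒≡false (λ t → x≢y (≡ᵇ⇒≡ x y t))

≡ᵇ-cancelˡ-+ : ∀ k x y → (k + x ≡ᵇ k + y) ≡ (x ≡ᵇ y)
≡ᵇ-cancelˡ-+ zero x y = refl
≡ᵇ-cancelˡ-+ (suc k) x y = ≡ᵇ-cancelˡ-+ k x y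

<ᵇ-cancelˡ-+ : ∀ k x y → (k + x <ᵇ k + y) ≡ (x <ᵇ y)
<ᵇ-cancelˡ-+ zero x y = refl
<ᵇ-cancelˡ-+ (suc k) x y = <ᵇ-cancelˡ-+ k x y

indicator : Bool → ℕ
indicator true = 1
indicator false = 0

all⁺ : ∀ {A : Set} (p : A → Bool) xs → (∀ x → x ∈ xs → T (p x)) → T (all p xs)
all⁺ p [] f = tt
all⁺ p (x ∷ xs) f = T-∧⁺ (f x (here refl)) (all⁺ p xs (λ y y∈ → f y (there y∈)))

all⁻ : ∀ {A : Set} (p : A → Bool) xs → T (all p xs) → ∀ x → x ∈ xs → T (p x)
all⁻ p (y ∷ xs) t x (here refl) = T-∧⁻ˡ t
all⁻ p (y ∷ xs) t x (there x∈) = all⁻ p xs (T-∧⁻ʳ {p y} t) x x∈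

all-cong : ∀ {A : Set} (p q : A → Bool) xs → (∀ x → x ∈ xs → p x ≡ q x) → all p xs ≡ all q xs
all-cong p q [] h = refl
all-cong p q (x ∷ xs) h = cong₂ _∧_ (h x (here refl)) (all-cong p q xs (λ y y∈ → h y (there y∈)))

all-↭ : ∀ {A : Set} (p : A → Bool) {xs ys} → xs ↭ ys → all p xs ≡ all p ys
all-↭ p {xs} {ys} xs↭ys =
  T-ext (λ t → all⁺ p ys (λ x x∈ → all⁻ p xs t x (∈-resp-↭ (↭-sym xs↭ys) x∈)))
        (λ t → all⁺ p xs (λ x x∈ → all⁻ p ys t x (∈-resp-↭ xs↭ys x∈)))

∈-range1⁻ : ∀ {n x} → x ∈ range1 n → 1 ≤ x × x ≤ n
∈-range1⁻ x∈ with ∈-map⁻ suc x∈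
... | y , y∈ , refl = s≤s z≤n , ∈-upTo⁻ y∈

∈-range1⁺ : ∀ {n x} → 1 ≤ x → x ≤ n → x ∈ range1 n
∈-range1⁺ {n} {suc x} _ x≤n = ∈-map⁺ suc (∈-upTo⁺ x≤n)

all-range1⁺ : ∀ (p : ℕ → Bool) n → (∀ x → 1 ≤ x → x ≤ n → T (p x)) → T (all p (range1 n))
all-range1⁺ p n f = all⁺ p (range1 n) (λ x x∈ → f x (proj₁ (∈-range1⁻ x∈)) (proj₂ (∈-range1⁻ x∈)))

all-range1⁻ : ∀ (p : ℕ → Bool) n → T (all p (range1 n)) → ∀ x → 1 ≤ x → x ≤ n → T (p x)
all-range1⁻ p n t x 1≤x x≤n = all⁻ p (range1 n) t x (∈-range1⁺ 1≤x x≤n)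

all-upTo⁺ : ∀ (p : ℕ → Bool) n → (∀ x → x < n → T (p x)) → T (all p (upTo n))
all-upTo⁺ p n f = all⁺ p (upTo n) (λ x x∈ → f x (∈-upTo⁻ x∈))

all-upTo⁻ : ∀ (p : ℕ → Bool) n → T (all p (upTo n)) → ∀ x → x < n → T (p x)
all-upTo⁻ p n t x x<n = all⁻ p (upTo n) t x (∈-upTo⁺ x<n)

-- Counting sublists

countWhere : ∀ {A : Set} → (A → Bool) → List A → ℕ
countWhere p xs = length (filter (λ x → T? (p x)) xs)

countWhere-∷ : ∀ {A : Set} (p : A → Bool) x xs → countWhere p (x ∷ xs) ≡ indicator (p x) + countWhere p xs
countWhere-∷ p x xs with p x
... | true = refl
... | false = refl

countWhere-++ : ∀ {A : Set} (p : A → Bool) xs ys → countWhere p (xs ++ ys) ≡ countWhere p xs + countWhere p ys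
countWhere-++ p [] ys = refl
countWhere-++ p (x ∷ xs) ys with p x
... | true = cong suc (countWhere-++ p xs ys)
... | false = countWhere-++ p xs ys

countWhere-map : ∀ {A B : Set} (p : B → Bool) (f : A → B) xs →
                 countWhere p (map f xs) ≡ countWhere (λ x → p (f x)) xs
countWhere-map p f [] = refl
countWhere-map p f (x ∷ xs) with p (f x)
... | true = cong suc (countWhere-map p f xs)
... | false = countWhere-map p f xs

countWhere-cong : ∀ {A : Set} (p q : A → Bool) xs → (∀ x → x ∈ xs → p x ≡ q x) →
                  countWhere p xs ≡ countWhere q xs
countWhere-cong p q [] h = refl
countWhere-cong p q (x ∷ xs) h with p x | q x | h x (here refl)
... | true | .true | refl = cong suc (countWhere-cong p q xs (λ y y∈ → h y (there y∈)))
... | false | .false | refl = countWhere-cong p q xs (λ y y∈ → h y (there y∈))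

countWhere-none : ∀ {A : Set} (p : A → Bool) xs → (∀ x → x ∈ xs → p x ≡ false) → countWhere p xs ≡ 0
countWhere-none p [] h = refl
countWhere-none p (x ∷ xs) h with p x | h x (here refl)
... | false | _ = countWhere-none p xs (λ y y∈ → h y (there y∈))

countWhere-pos : ∀ {A : Set} (p : A → Bool) xs x → x ∈ xs → T (p x) → 0 < countWhere p xs
countWhere-pos p (y ∷ xs) x (here refl) t with p y
... | true = s≤s z≤n
countWhere-pos p (y ∷ xs) x (there x∈) t with p y
... | true = s≤s z≤n
... | false = countWhere-pos p xs x x∈ t

countWhere-↭ : ∀ {A : Set} (p : A → Bool) {xs ys} → xs ↭ ys → countWhere p xs ≡ countWhere p ys
countWhere-↭ p ↭-refl = refl
countWhere-↭ p (prep x xs↭ys) with p x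
... | true = cong suc (countWhere-↭ p xs↭ys)
... | false = countWhere-↭ p xs↭ys
countWhere-↭ p (swap {xs} {ys} x y xs↭ys) = begin
    countWhere p (x ∷ y ∷ xs)
  ≡⟨ countWhere-∷ p x (y ∷ xs) ⟩
    indicator (p x) + countWhere p (y ∷ xs)
  ≡⟨ cong (indicator (p x) +_) (countWhere-∷ p y xs) ⟩
    indicator (p x) + (indicator (p y) + countWhere p xs)
  ≡⟨ x∙yz≈y∙xz (indicator (p x)) (indicator (p y)) _ ⟩
    indicator (p y) + (indicator (p x) + countWhere p xs)
  ≡⟨ cong (λ c → indicator (p y) + (indicator (p x) + c)) (countWhere-↭ p xs↭ys) ⟩
    indicator (p y) + (indicator (p x) + countWhere p ys)
  ≡⟨ cong (indicator (p y) +_) (countWhere-∷ p x ys) ⟨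
    indicator (p y) + countWhere p (x ∷ ys)
  ≡⟨ countWhere-∷ p y (x ∷ ys) ⟨
    countWhere p (y ∷ x ∷ ys)
  ∎
  where open ≡-Reasoning
countWhere-↭ p (↭-trans xs↭ys ys↭zs) = trans (countWhere-↭ p xs↭ys) (countWhere-↭ p ys↭zs)

countSublists : ∀ {A : Set} → (List A → Bool) → List A → ℕ
countSublists P xs = countWhere P (sublists xs)

countSublists-[] : ∀ {A : Set} (P : List A → Bool) → countSublists P [] ≡ indicator (P [])
countSublists-[] P with P []
... | true = refl
... | false = refl

countSublists-∷ : ∀ {A : Set} (P : List A → Bool) x xs →
                  countSublists P (x ∷ xs) ≡ countSublists P xs + countSublists (λ D → P (x ∷ D)) xs
countSublists-∷ P x xs = trans (countWhere-++ P (sublists xs) (map (x ∷_) (sublists xs)))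
                               (cong (countSublists P xs +_) (countWhere-map P (x ∷_) (sublists xs)))

countSublists-ext : ∀ {A : Set} (P Q : List A → Bool) xs → (∀ D → P D ≡ Q D) →
                    countSublists P xs ≡ countSublists Q xs
countSublists-ext P Q xs h = countWhere-cong P Q (sublists xs) (λ D _ → h D)

module _ {A : Set} (R : A → Set) where

  countSublists-congOn : ∀ (P Q : List A → Bool) xs → (∀ D → All R D → P D ≡ Q D) → All R xs →
                         countSublists P xs ≡ countSublists Q xs
  countSublists-congOn P Q [] h _ = trans (countSublists-[] P) (trans (cong indicator (h [] [])) (sym (countSublists-[] Q)))
  countSublists-congOn P Q (x ∷ xs) h (rx ∷ rxs) = begin
      countSublists P (x ∷ xs)
    ≡⟨ countSublists-∷ P x xs ⟩
      countSublists P xs + countSublists (λ D → P (x ∷ D)) xs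
    ≡⟨ cong₂ _+_ (countSublists-congOn P Q xs h rxs)
                 (countSublists-congOn _ _ xs (λ D rD → h (x ∷ D) (rx ∷ rD)) rxs) ⟩
      countSublists Q xs + countSublists (λ D → Q (x ∷ D)) xs
    ≡⟨ countSublists-∷ Q x xs ⟨
      countSublists Q (x ∷ xs)
    ∎
    where open ≡-Reasoning

  countSublists-noneOn : ∀ (P : List A → Bool) xs → (∀ D → All R D → ¬ T (P D)) → All R xs →
                         countSublists P xs ≡ 0
  countSublists-noneOn P [] h _ with P [] | h []
  ... | true | ¬P[] = ⊥-elim (¬P[] [] tt)
  ... | false | _ = refl
  countSublists-noneOn P (x ∷ xs) h (rx ∷ rxs) =
    trans (countSublists-∷ P x xs)
      (cong₂ _+_ (countSublists-noneOn P xs h rxs)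
                 (countSublists-noneOn _ xs (λ D rD → h (x ∷ D) (rx ∷ rD)) rxs))

  countSublists-filterOn : ∀ (q : A → Bool) (P : List A → Bool) xs →
                           (∀ D → All R D → T (P D) → All (λ a → T (q a)) D) → All R xs →
                           countSublists P xs ≡ countSublists P (filter (λ a → T? (q a)) xs)
  countSublists-filterOn q P [] h _ = refl
  countSublists-filterOn q P (x ∷ xs) h (rx ∷ rxs) with q x in qx
  ... | true = trans (countSublists-∷ P x xs)
                 (trans (cong₂ _+_ (countSublists-filterOn q P xs h rxs)
                                   (countSublists-filterOn q _ xs (λ D rD t → All.tail (h (x ∷ D) (rx ∷ rD) t)) rxs))
                        (sym (countSublists-∷ P x (filter (λ a → T? (q a)) xs))))
  ... | false = trans (countSublists-∷ P x xs)
                  (trans (cong₂ _+_ (countSublists-filterOn q P xs h rxs)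
                                    (countSublists-noneOn _ xs (λ D rD t → q-fails (h (x ∷ D) (rx ∷ rD) t)) rxs))
                         (+-identityʳ _))
    where
    q-fails : ∀ {D} → ¬ All (λ a → T (q a)) (x ∷ D)
    q-fails (qx' ∷ _) rewrite qx = qx'

countSublists-map : ∀ {A B : Set} (P : List B → Bool) (f : A → B) xs →
                    countSublists P (map f xs) ≡ countSublists (λ D → P (map f D)) xs
countSublists-map P f [] = trans (countSublists-[] P) (sym (countSublists-[] (λ D → P (map f D))))
countSublists-map P f (x ∷ xs) =
  trans (countSublists-∷ P (f x) (map f xs))
    (trans (cong₂ _+_ (countSublists-map P f xs) (countSublists-map (λ D → P (f x ∷ D)) f xs))
           (sym (countSublists-∷ (λ D → P (map f D)) x xs)))

countSublists-↭ : ∀ {A : Set} (P : List A → Bool) → (∀ {D D'} → D ↭ D' → P D ≡ P D') →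
                  ∀ {xs ys} → xs ↭ ys → countSublists P xs ≡ countSublists P ys
countSublists-↭ P inv ↭-refl = refl
countSublists-↭ P inv (prep {xs} {ys} x xs↭ys) =
  trans (countSublists-∷ P x xs)
    (trans (cong₂ _+_ (countSublists-↭ P inv xs↭ys) (countSublists-↭ _ (λ q → inv (prep x q)) xs↭ys))
           (sym (countSublists-∷ P x ys)))
countSublists-↭ P inv {x ∷ y ∷ xs} {y ∷ x ∷ ys} (swap x y xs↭ys) = begin
    # P (x ∷ y ∷ xs)
  ≡⟨ countSublists-∷ P x (y ∷ xs) ⟩
    # P (y ∷ xs) + # Px (y ∷ xs)
  ≡⟨ cong₂ _+_ (countSublists-∷ P y xs) (countSublists-∷ Px y xs) ⟩
    (# P xs + # Py xs) + (# Px xs + # Pxy xs)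
  ≡⟨ cong₂ _+_ (cong₂ _+_ (countSublists-↭ P inv xs↭ys) (countSublists-↭ Py (λ q → inv (prep y q)) xs↭ys))
               (cong₂ _+_ (countSublists-↭ Px (λ q → inv (prep x q)) xs↭ys)
                          (trans (countSublists-↭ Pxy (λ q → inv (prep x (prep y q))) xs↭ys)
                                 (countSublists-ext Pxy Pyx ys (λ _ → inv (swap x y ↭-refl))))) ⟩
    (# P ys + # Py ys) + (# Px ys + # Pyx ys)
  ≡⟨ interchange (# P ys) (# Py ys) (# Px ys) (# Pyx ys) ⟩
    (# P ys + # Px ys) + (# Py ys + # Pyx ys)
  ≡⟨ cong₂ _+_ (countSublists-∷ P x ys) (countSublists-∷ Py x ys) ⟨
    # P (x ∷ ys) + # Py (x ∷ ys)
  ≡⟨ countSublists-∷ P y (x ∷ ys) ⟨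
    # P (y ∷ x ∷ ys)
  ∎
  where
  open ≡-Reasoning
  # = countSublists
  Px = λ D → P (x ∷ D)
  Py = λ D → P (y ∷ D)
  Pxy = λ D → P (x ∷ y ∷ D)
  Pyx = λ D → P (y ∷ x ∷ D)
countSublists-↭ P inv (↭-trans xs↭ys ys↭zs) = trans (countSublists-↭ P inv xs↭ys) (countSublists-↭ P inv ys↭zs)

↭-from-Unique : ∀ {A : Set} {xs ys : List A} → Unique xs → Unique ys →
                (∀ {a} → a ∈ xs → a ∈ ys) → (∀ {a} → a ∈ ys → a ∈ xs) → xs ↭ ys
↭-from-Unique u v f g = ∼bag⇒↭ (unique∧set⇒bag u v (mk⇔ f g))

map⁺-injectiveOn : ∀ {A B : Set} (f : A → B) xs →
                   (∀ {x y} → x ∈ xs → y ∈ xs → f x ≡ f y → x ≡ y) → Unique xs → Unique (map f xs)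
map⁺-injectiveOn f [] inj [] = []
map⁺-injectiveOn f (x ∷ xs) inj (x∉ ∷ u) =
  distinct xs x∉ (λ y∈ → inj (here refl) (there y∈)) ∷ map⁺-injectiveOn f xs (λ a b → inj (there a) (there b)) u
  where
  distinct : ∀ ys → All (x ≢_) ys → (∀ {y} → y ∈ ys → f x ≡ f y → x ≡ y) → All (f x ≢_) (map f ys)
  distinct [] [] _ = []
  distinct (y ∷ ys) (x≢y ∷ ns) h = (λ e → x≢y (h (here refl) e)) ∷ distinct ys ns (λ y∈ → h (there y∈))

ArcOn : ℕ → Arc → Set
ArcOn n (i , j) = 1 ≤ i × i < j × j ≤ n

arcsFrom : ℕ → ℕ → List Arc
arcsFrom n i = map (λ j → (i , j)) (filter (λ j → T? (i <ᵇ j)) (range1 n))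

∈-allArcs⁻ : ∀ {n a} → a ∈ allArcs n → ArcOn n a
∈-allArcs⁻ {n} a∈ with ∈-concat⁻′ (map (arcsFrom n) (range1 n)) a∈
... | xs , a∈xs , xs∈ with ∈-map⁻ (arcsFrom n) xs∈
... | i , i∈ , refl with ∈-map⁻ (λ j → (i , j)) a∈xs
... | j , j∈ , refl with ∈-filter⁻ (λ j → T? (i <ᵇ j)) j∈
... | j∈range , i<ᵇj = proj₁ (∈-range1⁻ i∈) , <ᵇ⁻ i<ᵇj , proj₂ (∈-range1⁻ j∈range)

∈-allArcs⁺ : ∀ {n a} → ArcOn n a → a ∈ allArcs n
∈-allArcs⁺ {n} {i , j} (1≤i , i<j , j≤n) =
  ∈-concat⁺′ (∈-map⁺ (λ j → (i , j)) (∈-filter⁺ (λ j → T? (i <ᵇ j)) (∈-range1⁺ (≤-trans 1≤i (<⇒≤ i<j)) j≤n) (<ᵇ⁺ i<j)))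
             (∈-map⁺ (arcsFrom n) (∈-range1⁺ 1≤i (≤-trans (<⇒≤ i<j) j≤n)))

allArcs-ArcOn : ∀ n → All (ArcOn n) (allArcs n)
allArcs-ArcOn n = All.tabulate ∈-allArcs⁻

range1-Unique : ∀ n → Unique (range1 n)
range1-Unique n = Uniqueₚ.map⁺ suc-injective (Uniqueₚ.upTo⁺ n)

allArcs-Unique : ∀ n → Unique (allArcs n)
allArcs-Unique n =
  Uniqueₚ.concat⁺ (All.tabulate arcsFrom-Unique) (AllPairsₚ.map⁺ (AllPairs.map arcsFrom-disjoint (range1-Unique n)))
  where
  arcsFrom-Unique : ∀ {xs} → xs ∈ map (arcsFrom n) (range1 n) → Unique xs
  arcsFrom-Unique xs∈ with ∈-map⁻ (arcsFrom n) xs∈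
  ... | i , _ , refl = Uniqueₚ.map⁺ (cong proj₂) (Uniqueₚ.filter⁺ (λ j → T? (i <ᵇ j)) (range1-Unique n))
  source : ∀ {i a} → a ∈ arcsFrom n i → proj₁ a ≡ i
  source {i} a∈ with ∈-map⁻ (λ j → (i , j)) a∈
  ... | j , _ , refl = refl
  arcsFrom-disjoint : ∀ {i i'} → i ≢ i' → Disjoint (arcsFrom n i) (arcsFrom n i')
  arcsFrom-disjoint i≢i' (a∈ , a∈') = i≢i' (trans (sym (source a∈)) (source a∈'))

ld-pos : ∀ D a → a ∈ D → 0 < ld D (proj₂ a)
ld-pos D a a∈ = countWhere-pos (λ b → proj₂ b ≡ᵇ proj₂ a) D a a∈ (≡⇒≡ᵇ (proj₂ a) (proj₂ a) refl)

rd-pos : ∀ D a → a ∈ D → 0 < rd D (proj₁ a)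
rd-pos D a a∈ = countWhere-pos (λ b → proj₁ b ≡ᵇ proj₁ a) D a a∈ (≡⇒≡ᵇ (proj₁ a) (proj₁ a) refl)

ld-pos⇒arc : ∀ D v → 0 < ld D v → Σ Arc λ a → a ∈ D × proj₂ a ≡ v
ld-pos⇒arc (a ∷ D) v p with proj₂ a ≡ᵇ v in eq
... | true = a , here refl , ≡ᵇ⇒≡ (proj₂ a) v (subst T (sym eq) tt)
... | false with ld-pos⇒arc D v p
... | b , b∈ , e = b , there b∈ , e

rd-pos⇒arc : ∀ D v → 0 < rd D v → Σ Arc λ a → a ∈ D × proj₁ a ≡ v
rd-pos⇒arc (a ∷ D) v p with proj₁ a ≡ᵇ v in eq
... | true = a , here refl , ≡ᵇ⇒≡ (proj₁ a) v (subst T (sym eq) tt)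
... | false with rd-pos⇒arc D v p
... | b , b∈ , e = b , there b∈ , e

ld-pos⇒bounds : ∀ {n D w} → All (ArcOn n) D → 0 < ld D w → 2 ≤ w × w ≤ n
ld-pos⇒bounds {n} {D} {w} arcs p with ld-pos⇒arc D w p
... | (i , j) , a∈ , refl with All.lookup arcs a∈
... | 1≤i , i<j , j≤n = ≤-trans (s≤s 1≤i) i<j , j≤n

rd-pos⇒bounds : ∀ {n D w} → All (ArcOn n) D → 0 < rd D w → 1 ≤ w × w < n
rd-pos⇒bounds {n} {D} {w} arcs p with rd-pos⇒arc D w p
... | (i , j) , a∈ , refl with All.lookup arcs a∈
... | 1≤i , i<j , j≤n = 1≤i , <-≤-trans i<j j≤n

ld-outside : ∀ {n D v} → All (ArcOn n) D → v < 2 ⊎ n < v → ld D v ≡ 0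
ld-outside {n} {D} {v} arcs out = countWhere-none _ D (λ a a∈ → ≢⇒≡ᵇ-false (target≢ a (All.lookup arcs a∈)))
  where
  target≢ : ∀ a → ArcOn n a → proj₂ a ≢ v
  target≢ (i , j) (1≤i , i<j , j≤n) refl =
    [ (λ v<2 → <⇒≱ v<2 (≤-trans (s≤s 1≤i) i<j)) , (λ n<v → <⇒≱ n<v j≤n) ]′ out

rd-outside : ∀ {n D v} → All (ArcOn n) D → v < 1 ⊎ n ≤ v → rd D v ≡ 0
rd-outside {n} {D} {v} arcs out = countWhere-none _ D (λ a a∈ → ≢⇒≡ᵇ-false (source≢ a (All.lookup arcs a∈)))
  where
  source≢ : ∀ a → ArcOn n a → proj₁ a ≢ v
  source≢ (i , j) (1≤i , i<j , j≤n) refl =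
    [ (λ v<1 → <⇒≱ v<1 1≤i) , (λ n≤v → <⇒≱ (<-≤-trans i<j j≤n) n≤v) ]′ out

deg-first : ∀ {n D} → All (ArcOn n) D → deg D 1 ≡ rd D 1
deg-first {n} {D} arcs rewrite ld-outside {n} {D} {1} arcs (inj₁ (s≤s (s≤s z≤n))) = refl

deg-last : ∀ {n D} → All (ArcOn n) D → deg D n ≡ ld D n
deg-last {n} {D} arcs rewrite rd-outside {n} {D} {n} arcs (inj₂ ≤-refl) = +-identityʳ _

NoCrossing : Diagram → Set
NoCrossing D = ∀ a b → a ∈ D → b ∈ D → ¬ T (crossB a b)

ZigzagDegrees : ℕ → Diagram → Set
ZigzagDegrees n D = ∀ v → 1 ≤ v → v ≤ n → ld D v + rd D v ≤ 2 × (0 < ld D v → ¬ 0 < rd D v)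

ReducedReach : ℕ → ℕ → Diagram → Set
ReducedReach m n D = ∀ i → 1 ≤ i → i ≤ n → i + m ∸ 1 ≤ n → ld D i + rd D (i + m ∸ 1) ≤ 2

ReducedGap : ℕ → ℕ → Diagram → Set
ReducedGap m n D = ∀ i j → 1 ≤ i → i ≤ n → 1 ≤ j → j ≤ n → i < j → 0 < ld D i → 0 < rd D j → m ∸ 1 ≤ j ∸ i

record ReducedZigzag (m n : ℕ) (D : Diagram) : Set where
  constructor mkReducedZigzag
  field
    noCrossing : NoCrossing D
    degrees : ZigzagDegrees n D
    reach : ReducedReach m n D
    gap : ReducedGap m n D
open ReducedZigzag public

isRZ⇒ReducedZigzag : ∀ m n D → T (isRZ m n D) → ReducedZigzag m n D
isRZ⇒ReducedZigzag m n D t = mkReducedZigzag noCrossing′ degrees′ reach′ gap′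
  where
  zigzag = T-∧⁻ˡ t
  reduced = T-∧⁻ʳ {isZigzag n D} t
  noCrossing′ : NoCrossing D
  noCrossing′ a b a∈ b∈ = T-not⁻ (all⁻ _ D (all⁻ _ D (T-∧⁻ˡ zigzag) a a∈) b b∈)
  degrees′ : ZigzagDegrees n D
  degrees′ v 1≤v v≤n =
    let tv = all-range1⁻ _ n (T-∧⁻ʳ {isStack D} zigzag) v 1≤v v≤n in
    ≤ᵇ⁻ (T-∧⁻ˡ tv) , (λ l r → T-not⁻ (T-∧⁻ʳ {deg D v ≤ᵇ 2} tv) (T-∧⁺ (<ᵇ⁺ l) (<ᵇ⁺ r)))
  reach′ : ReducedReach m n D
  reach′ i 1≤i i≤n c = ≤ᵇ⁻ (T-if⁻ (all-range1⁻ _ n (T-∧⁻ˡ reduced) i 1≤i i≤n) (≤ᵇ⁺ c))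
  gap′ : ReducedGap m n D
  gap′ i j 1≤i i≤n 1≤j j≤n i<j l r =
    ≤ᵇ⁻ (T-if⁻ (all-range1⁻ _ n (all-range1⁻ _ n (T-∧⁻ʳ {all _ (range1 n)} reduced) i 1≤i i≤n) j 1≤j j≤n)
               (T-∧⁺ (<ᵇ⁺ i<j) (T-∧⁺ (<ᵇ⁺ l) (<ᵇ⁺ r))))

ReducedZigzag⇒isRZ : ∀ m n D → ReducedZigzag m n D → T (isRZ m n D)
ReducedZigzag⇒isRZ m n D s = T-∧⁺ (T-∧⁺ stack zigzag) (T-∧⁺ reduced₁ reduced₂)
  where
  stack = all⁺ _ D (λ a a∈ → all⁺ _ D (λ b b∈ → T-not⁺ (noCrossing s a b a∈ b∈)))
  zigzag = all-range1⁺ _ n (λ v 1≤v v≤n → T-∧⁺ (≤ᵇ⁺ (proj₁ (degrees s v 1≤v v≤n)))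
             (T-not⁺ (λ t → proj₂ (degrees s v 1≤v v≤n) (<ᵇ⁻ (T-∧⁻ˡ t)) (<ᵇ⁻ (T-∧⁻ʳ {0 <ᵇ ld D v} t)))))
  reduced₁ = all-range1⁺ _ n (λ i 1≤i i≤n → T-if⁺ (λ c → ≤ᵇ⁺ (reach s i 1≤i i≤n (≤ᵇ⁻ c))))
  reduced₂ = all-range1⁺ _ n (λ i 1≤i i≤n → all-range1⁺ _ n (λ j 1≤j j≤n → T-if⁺ (λ c →
               let c′ = T-∧⁻ʳ {i <ᵇ j} c in
               ≤ᵇ⁺ (gap s i j 1≤i i≤n 1≤j j≤n (<ᵇ⁻ (T-∧⁻ˡ c)) (<ᵇ⁻ (T-∧⁻ˡ c′)) (<ᵇ⁻ (T-∧⁻ʳ {0 <ᵇ ld D i} c′))))))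

ReducedZigzag-[] : ∀ m n → ReducedZigzag m n []
ReducedZigzag-[] m n = mkReducedZigzag (λ a b ()) (λ v _ _ → z≤n , λ ()) (λ _ _ _ _ → z≤n) (λ _ _ _ _ _ _ _ ())

degrees-everywhere : ∀ {n D} → All (ArcOn n) D → ZigzagDegrees n D →
                     ∀ w → ld D w + rd D w ≤ 2 × (0 < ld D w → ¬ 0 < rd D w)
degrees-everywhere {n} {D} arcs zz w with 1 ≤? w | w ≤? n
... | yes 1≤w | yes w≤n = zz w 1≤w w≤n
... | no w≱1 | _
  rewrite ld-outside {n} {D} {w} arcs (inj₁ (≤-trans (≰⇒> w≱1) (s≤s z≤n)))
        | rd-outside {n} {D} {w} arcs (inj₁ (≰⇒> w≱1)) = z≤n , λ ()
... | yes _ | no w≰n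
  rewrite ld-outside {n} {D} {w} arcs (inj₂ (≰⇒> w≰n))
        | rd-outside {n} {D} {w} arcs (inj₂ (<⇒≤ (≰⇒> w≰n))) = z≤n , λ ()

ld≤2 : ∀ {n D} → All (ArcOn n) D → ZigzagDegrees n D → ∀ w → ld D w ≤ 2
ld≤2 {D = D} arcs zz w = ≤-trans (m≤m+n (ld D w) (rd D w)) (proj₁ (degrees-everywhere arcs zz w))

rd≤2 : ∀ {n D} → All (ArcOn n) D → ZigzagDegrees n D → ∀ w → rd D w ≤ 2
rd≤2 {D = D} arcs zz w = ≤-trans (m≤n+m (rd D w) (ld D w)) (proj₁ (degrees-everywhere arcs zz w))

-- Shifting a diagram to the right

shiftArc : ℕ → Arc → Arc
shiftArc k (i , j) = (k + i , k + j)

shiftDiagram : ℕ → Diagram → Diagram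
shiftDiagram k = map (shiftArc k)

shiftArc-injective : ∀ k {x y} → shiftArc k x ≡ shiftArc k y → x ≡ y
shiftArc-injective k {i , j} {i' , j'} e =
  cong₂ _,_ (+-cancelˡ-≡ k i i' (cong proj₁ e)) (+-cancelˡ-≡ k j j' (cong proj₂ e))

ArcOn-shift : ∀ k n r {a} → ArcOn n a → ArcOn (k + n + r) (shiftArc k a)
ArcOn-shift k n r {i , j} (1≤i , i<j , j≤n) =
  ≤-trans 1≤i (m≤n+m i k) , +-monoʳ-< k i<j , ≤-trans (+-monoʳ-≤ k j≤n) (m≤m+n (k + n) r)

crossB-shift : ∀ k a b → crossB (shiftArc k a) (shiftArc k b) ≡ crossB a b
crossB-shift k (i₁ , j₁) (i₂ , j₂)
  rewrite <ᵇ-cancelˡ-+ k i₁ i₂ | <ᵇ-cancelˡ-+ k i₂ j₁ | <ᵇ-cancelˡ-+ k j₁ j₂ = refl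

ld-shift : ∀ k D w → ld (shiftDiagram k D) (k + w) ≡ ld D w
ld-shift k D w = trans (countWhere-map (λ a → proj₂ a ≡ᵇ (k + w)) (shiftArc k) D)
                       (countWhere-cong _ _ D (λ a _ → ≡ᵇ-cancelˡ-+ k (proj₂ a) w))

rd-shift : ∀ k D w → rd (shiftDiagram k D) (k + w) ≡ rd D w
rd-shift k D w = trans (countWhere-map (λ a → proj₁ a ≡ᵇ (k + w)) (shiftArc k) D)
                       (countWhere-cong _ _ D (λ a _ → ≡ᵇ-cancelˡ-+ k (proj₁ a) w))

ld-shift-prefix : ∀ {n} k D v → All (ArcOn n) D → v ≤ k → ld (shiftDiagram k D) v ≡ 0
ld-shift-prefix {n} k D v arcs v≤k =
  trans (countWhere-map (λ a → proj₂ a ≡ᵇ v) (shiftArc k) D)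
        (countWhere-none _ D (λ a a∈ → ≢⇒≡ᵇ-false (target≢ a (All.lookup arcs a∈))))
  where
  target≢ : ∀ a → ArcOn n a → k + proj₂ a ≢ v
  target≢ (i , j) (1≤i , i<j , j≤n) e =
    <⇒≱ (≤-trans (s≤s v≤k) (subst (suc k ≤_) e (m<m+n k (≤-trans 1≤i (<⇒≤ i<j))))) ≤-refl

rd-shift-prefix : ∀ {n} k D v → All (ArcOn n) D → v ≤ k → rd (shiftDiagram k D) v ≡ 0
rd-shift-prefix {n} k D v arcs v≤k =
  trans (countWhere-map (λ a → proj₁ a ≡ᵇ v) (shiftArc k) D)
        (countWhere-none _ D (λ a a∈ → ≢⇒≡ᵇ-false (source≢ a (All.lookup arcs a∈))))
  where
  source≢ : ∀ a → ArcOn n a → k + proj₁ a ≢ v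
  source≢ (i , j) (1≤i , i<j , j≤n) e = <⇒≱ (≤-trans (s≤s v≤k) (subst (suc k ≤_) e (m<m+n k 1≤i))) ≤-refl

data ShiftPosition (k v : ℕ) : Set where
  inPrefix : v ≤ k → ShiftPosition k v
  shifted : ∀ w → 1 ≤ w → v ≡ k + w → ShiftPosition k v

shiftPosition : ∀ k v → ShiftPosition k v
shiftPosition k v with v ≤? k
... | yes v≤k = inPrefix v≤k
... | no v≰k = shifted (v ∸ k) (m<n⇒0<n∸m (≰⇒> v≰k)) (sym (m+[n∸m]≡n (<⇒≤ (≰⇒> v≰k))))

ld-shift≤2 : ∀ k {n D} → All (ArcOn n) D → ZigzagDegrees n D → ∀ i → ld (shiftDiagram k D) i ≤ 2
ld-shift≤2 k {D = D} arcs zz i with shiftPosition k i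
... | inPrefix i≤k rewrite ld-shift-prefix k D i arcs i≤k = z≤n
... | shifted w _ refl rewrite ld-shift k D w = ld≤2 arcs zz w

+-∸1-assoc : ∀ k w m → 1 ≤ w → (k + w) + m ∸ 1 ≡ k + (w + m ∸ 1)
+-∸1-assoc k w m 1≤w = trans (cong (_∸ 1) (+-assoc k w m)) (+-∸-assoc k (≤-trans 1≤w (m≤m+n w m)))

module _ (m k n r : ℕ) (D : Diagram) (arcs : All (ArcOn n) D) where

  private
    N = k + n + r
    E = shiftDiagram k D

    k+w≤N : ∀ {w} → w ≤ n → k + w ≤ N
    k+w≤N w≤n = ≤-trans (+-monoʳ-≤ k w≤n) (m≤m+n (k + n) r)

    1≤k+w : ∀ {w} → 1 ≤ w → 1 ≤ k + w
    1≤k+w {w} 1≤w = ≤-trans 1≤w (m≤n+m w k)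

  ReducedZigzag-shift⁺ : ReducedZigzag m n D → ReducedZigzag m N E
  ReducedZigzag-shift⁺ s = mkReducedZigzag noCrossingE degreesE reachE gapE
    where
    arcsE : All (ArcOn N) E
    arcsE = Allₚ.map⁺ (All.map (ArcOn-shift k n r) arcs)
    noCrossingE : NoCrossing E
    noCrossingE a b a∈ b∈ c with ∈-map⁻ (shiftArc k) a∈ | ∈-map⁻ (shiftArc k) b∈
    ... | a' , a'∈ , refl | b' , b'∈ , refl = noCrossing s a' b' a'∈ b'∈ (subst T (crossB-shift k a' b') c)
    degreesE : ZigzagDegrees N E
    degreesE v 1≤v v≤N with shiftPosition k v
    ... | inPrefix v≤k rewrite ld-shift-prefix k D v arcs v≤k | rd-shift-prefix k D v arcs v≤k = z≤n , λ ()
    ... | shifted w 1≤w refl rewrite ld-shift k D w | rd-shift k D w = degrees-everywhere arcs (degrees s) w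
    reachE : ReducedReach m N E
    reachE i 1≤i i≤N c with shiftPosition k i
    ... | inPrefix i≤k rewrite ld-shift-prefix k D i arcs i≤k =
      ≤-trans (m≤n+m _ (ld E (i + m ∸ 1))) (proj₁ (degrees-everywhere arcsE degreesE (i + m ∸ 1)))
    ... | shifted w 1≤w refl rewrite +-∸1-assoc k w m 1≤w | ld-shift k D w | rd-shift k D (w + m ∸ 1)
      with w ≤? n | w + m ∸ 1 ≤? n
    ...   | yes w≤n | yes reach≤n = reach s w 1≤w w≤n reach≤n
    ...   | no w≰n | _ rewrite ld-outside {n} {D} {w} arcs (inj₂ (≰⇒> w≰n)) = rd≤2 arcs (degrees s) (w + m ∸ 1)
    ...   | yes _ | no reach≰n rewrite rd-outside {n} {D} {w + m ∸ 1} arcs (inj₂ (<⇒≤ (≰⇒> reach≰n))) =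
      subst (_≤ 2) (sym (+-identityʳ _)) (ld≤2 arcs (degrees s) w)
    gapE : ReducedGap m N E
    gapE i j 1≤i i≤N 1≤j j≤N i<j l r with shiftPosition k i | shiftPosition k j
    ... | inPrefix i≤k | _ rewrite ld-shift-prefix k D i arcs i≤k = ⊥-elim (<-irrefl refl l)
    ... | shifted w _ refl | inPrefix j≤k rewrite rd-shift-prefix k D j arcs j≤k = ⊥-elim (<-irrefl refl r)
    ... | shifted w 1≤w refl | shifted w' 1≤w' refl
      rewrite ld-shift k D w | rd-shift k D w' | [m+n]∸[m+o]≡n∸o k w' w =
        gap s w w' 1≤w (proj₂ (ld-pos⇒bounds arcs l)) 1≤w' (<⇒≤ (proj₂ (rd-pos⇒bounds arcs r)))
              (+-cancelˡ-< k w w' i<j) l r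

  ReducedZigzag-shift⁻ : ReducedZigzag m N E → ReducedZigzag m n D
  ReducedZigzag-shift⁻ s = mkReducedZigzag noCrossingD degreesD reachD gapD
    where
    noCrossingD : NoCrossing D
    noCrossingD a b a∈ b∈ c = noCrossing s (shiftArc k a) (shiftArc k b) (∈-map⁺ (shiftArc k) a∈) (∈-map⁺ (shiftArc k) b∈)
                                (subst T (sym (crossB-shift k a b)) c)
    degreesD : ZigzagDegrees n D
    degreesD w 1≤w w≤n = subst₂ (λ x y → x + y ≤ 2 × (0 < x → ¬ 0 < y)) (ld-shift k D w) (rd-shift k D w)
                           (degrees s (k + w) (1≤k+w 1≤w) (k+w≤N w≤n))
    reachD : ReducedReach m n D
    reachD w 1≤w w≤n c =
      subst₂ (λ x y → x + y ≤ 2) (ld-shift k D w) (trans (cong (rd E) (+-∸1-assoc k w m 1≤w)) (rd-shift k D (w + m ∸ 1)))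
        (reach s (k + w) (1≤k+w 1≤w) (k+w≤N w≤n) (subst (_≤ N) (sym (+-∸1-assoc k w m 1≤w)) (k+w≤N c)))
    gapD : ReducedGap m n D
    gapD w w' 1≤w w≤n 1≤w' w'≤n w<w' l r =
      subst (m ∸ 1 ≤_) ([m+n]∸[m+o]≡n∸o k w' w)
        (gap s (k + w) (k + w') (1≤k+w 1≤w) (k+w≤N w≤n) (1≤k+w 1≤w') (k+w≤N w'≤n) (+-monoʳ-< k w<w')
             (subst (0 <_) (sym (ld-shift k D w)) l) (subst (0 <_) (sym (rd-shift k D w')) r))

-- Boundary types

λext-right : ∀ a n D → λext a n D (suc n) ≡ 0
λext-right a n D rewrite ≡ᵇ-refl n = refl

ρext-right : ∀ b n D → ρext b n D (suc n) ≡ b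
ρext-right b n D rewrite ≡ᵇ-refl n = refl

λext-inner : ∀ a n D i → 1 ≤ i → i ≤ n → λext a n D i ≡ ld D i
λext-inner a n D (suc i) _ i≤n rewrite ≢⇒≡ᵇ-false {suc i} {suc n} (λ e → <-irrefl e (s≤s i≤n)) = refl

ρext-inner : ∀ b n D i → 1 ≤ i → i ≤ n → ρext b n D i ≡ rd D i
ρext-inner b n D (suc i) _ i≤n rewrite ≢⇒≡ᵇ-false {suc i} {suc n} (λ e → <-irrefl e (s≤s i≤n)) = refl

data ExtendedVertex (n i : ℕ) : Set where
  left : i ≡ 0 → ExtendedVertex n i
  inner : 1 ≤ i → i ≤ n → ExtendedVertex n i
  right : i ≡ suc n → ExtendedVertex n i

extendedVertex : ∀ n i → i < suc (suc n) → ExtendedVertex n i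
extendedVertex n zero _ = left refl
extendedVertex n (suc i) (s≤s (s≤s i≤n)) with i ≟ n
... | yes refl = right refl
... | no i≢n = inner (s≤s z≤n) (≤∧≢⇒< i≤n i≢n)

-- Conditions (i) and (ii) of the type (a , b) that involve the vertices 0 and ℓ+1.
record BoundaryConditions (m a b n : ℕ) (D : Diagram) : Set where
  constructor mkBoundaryConditions
  field
    leftReach : m ∸ 1 ≤ n → a + rd D (m ∸ 1) ≤ 2
    crossReach : m ∸ 1 ≡ suc n → a + b ≤ 2
    rightReach : ∀ i → 1 ≤ i → i ≤ n → i + m ∸ 1 ≡ suc n → ld D i + b ≤ 2
    leftGap : 0 < a → ∀ j → 1 ≤ j → j ≤ n → 0 < rd D j → m ∸ 1 ≤ j
    rightGap : 0 < b → ∀ i → 1 ≤ i → i ≤ n → 0 < ld D i → m ∸ 1 ≤ suc n ∸ i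
    crossGap : 0 < a → 0 < b → m ∸ 1 ≤ suc n
open BoundaryConditions public

BoundaryConditions-[] : ∀ {m a b n} → a ≤ 2 → b ≤ 2 → (m ∸ 1 ≡ suc n → a + b ≤ 2) →
                        (0 < a → 0 < b → m ∸ 1 ≤ suc n) → BoundaryConditions m a b n []
BoundaryConditions-[] {a = a} a≤2 b≤2 crossReach crossGap =
  mkBoundaryConditions (λ _ → subst (_≤ 2) (sym (+-identityʳ a)) a≤2) crossReach (λ _ _ _ _ → b≤2)
                       (λ _ _ _ _ ()) (λ _ _ _ _ ()) crossGap

module _ {m : ℕ} (2≤m : 2 ≤ m) (a b n : ℕ) (D : Diagram) where

  private
    1≤m∸1 : 1 ≤ m ∸ 1
    1≤m∸1 = ∸-monoˡ-≤ 1 2≤m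

    +m∸1 : ∀ i → i + m ∸ 1 ≡ i + (m ∸ 1)
    +m∸1 i = +-∸-assoc i (≤-trans (s≤s z≤n) 2≤m)

    inner< : ∀ {i} → i ≤ n → i < suc (suc n)
    inner< i≤n = s≤s (≤-trans i≤n (n≤1+n n))

    reachB : ℕ → Bool
    reachB i = if (i + m ∸ 1) ≤ᵇ suc n then (λext a n D i + ρext b n D (i + m ∸ 1)) ≤ᵇ 2 else true

    gapB : ℕ → ℕ → Bool
    gapB i j = if (i <ᵇ j) ∧ (0 <ᵇ λext a n D i) ∧ (0 <ᵇ ρext b n D j) then (m ∸ 1) ≤ᵇ (j ∸ i) else true

  hasType⇒BoundaryConditions : T (hasType m a b n D) → BoundaryConditions m a b n D
  hasType⇒BoundaryConditions t = mkBoundaryConditions leftReach′ crossReach′ rightReach′ leftGap′ rightGap′ crossGap′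
    where
    reachₑ : ∀ i → i < suc (suc n) → i + m ∸ 1 ≤ suc n → λext a n D i + ρext b n D (i + m ∸ 1) ≤ 2
    reachₑ i i< c = ≤ᵇ⁻ (T-if⁻ (all-upTo⁻ reachB (suc (suc n)) (T-∧⁻ˡ t) i i<) (≤ᵇ⁺ c))
    gapₑ : ∀ i j → i < suc (suc n) → j < suc (suc n) → i < j →
           0 < λext a n D i → 0 < ρext b n D j → m ∸ 1 ≤ j ∸ i
    gapₑ i j i< j< i<j l r =
      ≤ᵇ⁻ (T-if⁻ (all-upTo⁻ (gapB i) (suc (suc n))
                   (all-upTo⁻ (λ i → all (gapB i) (upTo (suc (suc n)))) (suc (suc n))
                              (T-∧⁻ʳ {all reachB (upTo (suc (suc n)))} t) i i<) j j<)
                 (T-∧⁺ (<ᵇ⁺ i<j) (T-∧⁺ (<ᵇ⁺ l) (<ᵇ⁺ r))))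
    leftReach′ : m ∸ 1 ≤ n → a + rd D (m ∸ 1) ≤ 2
    leftReach′ le = subst (λ x → a + x ≤ 2) (ρext-inner b n D (m ∸ 1) 1≤m∸1 le) (reachₑ 0 (s≤s z≤n) (≤-trans le (n≤1+n n)))
    crossReach′ : m ∸ 1 ≡ suc n → a + b ≤ 2
    crossReach′ e = subst (λ x → a + x ≤ 2) (trans (cong (ρext b n D) e) (ρext-right b n D)) (reachₑ 0 (s≤s z≤n) (≤-reflexive e))
    rightReach′ : ∀ i → 1 ≤ i → i ≤ n → i + m ∸ 1 ≡ suc n → ld D i + b ≤ 2
    rightReach′ i 1≤i i≤n e =
      subst₂ (λ x y → x + y ≤ 2) (λext-inner a n D i 1≤i i≤n) (trans (cong (ρext b n D) e) (ρext-right b n D))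
             (reachₑ i (inner< i≤n) (≤-reflexive e))
    leftGap′ : 0 < a → ∀ j → 1 ≤ j → j ≤ n → 0 < rd D j → m ∸ 1 ≤ j
    leftGap′ pa j 1≤j j≤n r = gapₑ 0 j (s≤s z≤n) (inner< j≤n) 1≤j pa (subst (0 <_) (sym (ρext-inner b n D j 1≤j j≤n)) r)
    rightGap′ : 0 < b → ∀ i → 1 ≤ i → i ≤ n → 0 < ld D i → m ∸ 1 ≤ suc n ∸ i
    rightGap′ pb i 1≤i i≤n l = gapₑ i (suc n) (inner< i≤n) ≤-refl (s≤s i≤n)
                                 (subst (0 <_) (sym (λext-inner a n D i 1≤i i≤n)) l) (subst (0 <_) (sym (ρext-right b n D)) pb)
    crossGap′ : 0 < a → 0 < b → m ∸ 1 ≤ suc n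
    crossGap′ pa pb = gapₑ 0 (suc n) (s≤s z≤n) ≤-refl (s≤s z≤n) pa (subst (0 <_) (sym (ρext-right b n D)) pb)

  BoundaryConditions⇒hasType : ReducedZigzag m n D → BoundaryConditions m a b n D → T (hasType m a b n D)
  BoundaryConditions⇒hasType s c =
    T-∧⁺ (all-upTo⁺ reachB (suc (suc n)) (λ i i< → T-if⁺ (λ le → ≤ᵇ⁺ (reachₑ i i< (≤ᵇ⁻ le)))))
         (all-upTo⁺ _ (suc (suc n)) (λ i i< → all-upTo⁺ (gapB i) (suc (suc n)) (λ j j< → T-if⁺ (λ q →
            let q′ = T-∧⁻ʳ {i <ᵇ j} q in
            ≤ᵇ⁺ (gapₑ i j i< j< (<ᵇ⁻ (T-∧⁻ˡ q)) (<ᵇ⁻ (T-∧⁻ˡ q′)) (<ᵇ⁻ (T-∧⁻ʳ {0 <ᵇ λext a n D i} q′)))))))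
    where
    reachₑ : ∀ i → i < suc (suc n) → i + m ∸ 1 ≤ suc n → λext a n D i + ρext b n D (i + m ∸ 1) ≤ 2
    reachₑ i i< le with extendedVertex n i i<
    ... | left refl with m≤n⇒m<n∨m≡n le
    ...   | inj₁ lt = subst (λ x → a + x ≤ 2) (sym (ρext-inner b n D (m ∸ 1) 1≤m∸1 (≤-pred lt))) (leftReach c (≤-pred lt))
    ...   | inj₂ e = subst (λ x → a + x ≤ 2) (sym (trans (cong (ρext b n D) e) (ρext-right b n D))) (crossReach c e)
    reachₑ i i< le | inner 1≤i i≤n rewrite λext-inner a n D i 1≤i i≤n with m≤n⇒m<n∨m≡n le
    ...   | inj₁ lt rewrite ρext-inner b n D (i + m ∸ 1) (≤-trans 1≤i (≤-trans (m≤m+n i (m ∸ 1)) (≤-reflexive (sym (+m∸1 i)))))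
                                       (≤-pred lt) =
      reach s i 1≤i i≤n (≤-pred lt)
    ...   | inj₂ e rewrite e | ρext-right b n D = rightReach c i 1≤i i≤n e
    reachₑ i i< le | right refl = ⊥-elim (<⇒≱ (m<m+n (suc n) 1≤m∸1) (subst (_≤ suc n) (+m∸1 (suc n)) le))
    gapₑ : ∀ i j → i < suc (suc n) → j < suc (suc n) → i < j →
           0 < λext a n D i → 0 < ρext b n D j → m ∸ 1 ≤ j ∸ i
    gapₑ i j i< j< i<j l r with extendedVertex n i i< | extendedVertex n j j<
    ... | _ | left refl = ⊥-elim (<-irrefl refl (≤-trans (s≤s z≤n) i<j))
    ... | left refl | inner 1≤j j≤n = leftGap c l j 1≤j j≤n (subst (0 <_) (ρext-inner b n D j 1≤j j≤n) r)
    ... | left refl | right refl = crossGap c l (subst (0 <_) (ρext-right b n D) r)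
    ... | inner 1≤i i≤n | inner 1≤j j≤n =
      gap s i j 1≤i i≤n 1≤j j≤n i<j (subst (0 <_) (λext-inner a n D i 1≤i i≤n) l) (subst (0 <_) (ρext-inner b n D j 1≤j j≤n) r)
    ... | inner 1≤i i≤n | right refl =
      rightGap c (subst (0 <_) (ρext-right b n D) r) i 1≤i i≤n (subst (0 <_) (λext-inner a n D i 1≤i i≤n) l)
    ... | right refl | _ = ⊥-elim (<-irrefl refl (subst (0 <_) (λext-right a n D) l))

SameProfile : Diagram → Diagram → Set
SameProfile D D' = (∀ v → ld D v ≡ ld D' v) × (∀ v → rd D v ≡ rd D' v) × isStack D ≡ isStack D'

↭⇒SameProfile : ∀ {D D'} → D ↭ D' → SameProfile D D'
↭⇒SameProfile {D} {D'} D↭D' =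
  (λ v → countWhere-↭ (λ a → proj₂ a ≡ᵇ v) D↭D') , (λ v → countWhere-↭ (λ a → proj₁ a ≡ᵇ v) D↭D') ,
  trans (all-↭ (λ a → all (λ b → not (crossB a b)) D) D↭D')
        (all-cong _ _ D' (λ a _ → all-↭ (λ b → not (crossB a b)) D↭D'))

isRZ-cong : ∀ m n {D D'} → SameProfile D D' → isRZ m n D ≡ isRZ m n D'
isRZ-cong m n (sameLd , sameRd , sameStack) =
  cong₂ _∧_
    (cong₂ _∧_ sameStack
       (all-cong _ _ (range1 n) (λ v _ →
          cong₂ (λ x y → ((x + y) ≤ᵇ 2) ∧ not ((0 <ᵇ x) ∧ (0 <ᵇ y))) (sameLd v) (sameRd v))))
    (cong₂ _∧_
       (all-cong _ _ (range1 n) (λ i _ →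
          cong₂ (λ x y → if (i + m ∸ 1) ≤ᵇ n then (x + y) ≤ᵇ 2 else true) (sameLd i) (sameRd (i + m ∸ 1))))
       (all-cong _ _ (range1 n) (λ i _ → all-cong _ _ (range1 n) (λ j _ →
          cong₂ (λ x y → if (i <ᵇ j) ∧ (0 <ᵇ x) ∧ (0 <ᵇ y) then (m ∸ 1) ≤ᵇ (j ∸ i) else true) (sameLd i) (sameRd j)))))

hasType-cong : ∀ m a b n {D D'} → SameProfile D D' → hasType m a b n D ≡ hasType m a b n D'
hasType-cong m a b n {D} {D'} (sameLd , sameRd , _) =
  cong₂ _∧_
    (all-cong _ _ (upTo (suc (suc n))) (λ i _ →
       cong₂ (λ x y → if (i + m ∸ 1) ≤ᵇ suc n then (x + y) ≤ᵇ 2 else true) (sameλ i) (sameρ (i + m ∸ 1))))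
    (all-cong _ _ (upTo (suc (suc n))) (λ i _ → all-cong _ _ (upTo (suc (suc n))) (λ j _ →
       cong₂ (λ x y → if (i <ᵇ j) ∧ (0 <ᵇ x) ∧ (0 <ᵇ y) then (m ∸ 1) ≤ᵇ (j ∸ i) else true) (sameλ i) (sameρ j))))
  where
  sameλ : ∀ i → λext a n D i ≡ λext a n D' i
  sameλ i = cong (λ x → if i ≡ᵇ 0 then a else if i ≡ᵇ suc n then 0 else x) (sameLd i)
  sameρ : ∀ i → ρext b n D i ≡ ρext b n D' i
  sameρ i = cong (λ x → if i ≡ᵇ 0 then 0 else if i ≡ᵇ suc n then b else x) (sameRd i)

-- Counting diagrams whose arcs lie in a window

inWindow : ℕ → ℕ → ℕ → Arc → Bool
inWindow k r n (i , j) = (k <ᵇ i) ∧ (j ≤ᵇ n ∸ r)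

inWindow-from-bounds : ∀ k r n {i j} → k < i → j + r ≤ n → T (inWindow k r n (i , j))
inWindow-from-bounds k r n {j = j} k<i j+r≤n = T-∧⁺ (<ᵇ⁺ k<i) (≤ᵇ⁺ (m+n≤o⇒m≤o∸n j j+r≤n))

window-↭-shift : ∀ k r n → filter (λ e → T? (inWindow k r (k + n + r) e)) (allArcs (k + n + r)) ↭ shiftDiagram k (allArcs n)
window-↭-shift k r n =
  ↭-from-Unique (Uniqueₚ.filter⁺ _ (allArcs-Unique N))
                (map⁺-injectiveOn (shiftArc k) (allArcs n) (λ _ _ → shiftArc-injective k) (allArcs-Unique n))
                windowed⇒shifted shifted⇒windowed
  where
  N = k + n + r
  N∸r : N ∸ r ≡ k + n
  N∸r = m+n∸n≡m (k + n) r
  windowed⇒shifted : ∀ {e} → e ∈ filter (λ e → T? (inWindow k r N e)) (allArcs N) → e ∈ shiftDiagram k (allArcs n)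
  windowed⇒shifted {i , j} e∈ with ∈-filter⁻ (λ e → T? (inWindow k r N e)) {xs = allArcs N} e∈
  ... | e∈N , w with ∈-allArcs⁻ {N} e∈N
  ... | _ , i<j , _ =
    let k<i = <ᵇ⁻ (T-∧⁻ˡ w)
        j≤k+n = subst (j ≤_) N∸r (≤ᵇ⁻ (T-∧⁻ʳ {k <ᵇ i} w))
        k≤i = <⇒≤ k<i
    in subst (_∈ shiftDiagram k (allArcs n)) (cong₂ _,_ (m+[n∸m]≡n k≤i) (m+[n∸m]≡n (≤-trans k≤i (<⇒≤ i<j))))
         (∈-map⁺ (shiftArc k) (∈-allArcs⁺ {n} {i ∸ k , j ∸ k}
            (m<n⇒0<n∸m k<i , ∸-monoˡ-< i<j k≤i , subst (j ∸ k ≤_) (m+n∸m≡n k n) (∸-monoˡ-≤ k j≤k+n))))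
  shifted⇒windowed : ∀ {e} → e ∈ shiftDiagram k (allArcs n) → e ∈ filter (λ e → T? (inWindow k r N e)) (allArcs N)
  shifted⇒windowed e∈ with ∈-map⁻ (shiftArc k) e∈
  ... | (i , j) , a∈ , refl with ∈-allArcs⁻ a∈
  ... | arc@(1≤i , _ , j≤n) =
    ∈-filter⁺ (λ e → T? (inWindow k r N e)) (∈-allArcs⁺ (ArcOn-shift k n r arc))
              (T-∧⁺ (<ᵇ⁺ (m<m+n k 1≤i)) (≤ᵇ⁺ (subst (k + j ≤_) (sym N∸r) (+-monoʳ-≤ k j≤n))))

module WindowedCount (k r : ℕ) (P Q : ℕ → Diagram → Bool)
  (P-↭ : ∀ n {D D'} → D ↭ D' → P n D ≡ P n D')
  (P⇒inWindow : ∀ n D → All (ArcOn n) D → T (P n D) → All (λ e → T (inWindow k r n e)) D)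
  (P-shift : ∀ n D → All (ArcOn n) D → P (k + n + r) (shiftDiagram k D) ≡ Q n D) where

  count-shifted : ∀ n → count (k + n + r) (P (k + n + r)) ≡ countSublists (Q n) (allArcs n)
  count-shifted n = begin
      countSublists (P N) (allArcs N)
    ≡⟨ countSublists-filterOn (ArcOn N) (inWindow k r N) (P N) (allArcs N) (P⇒inWindow N) (allArcs-ArcOn N) ⟩
      countSublists (P N) (filter _ (allArcs N))
    ≡⟨ countSublists-↭ (P N) (P-↭ N) (window-↭-shift k r n) ⟩
      countSublists (P N) (shiftDiagram k (allArcs n))
    ≡⟨ countSublists-map (P N) (shiftArc k) (allArcs n) ⟩
      countSublists (λ D → P N (shiftDiagram k D)) (allArcs n)
    ≡⟨ countSublists-congOn (ArcOn n) _ (Q n) (allArcs n) (P-shift n) (allArcs-ArcOn n) ⟩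
      countSublists (Q n) (allArcs n)
    ∎
    where
    open ≡-Reasoning
    N = k + n + r

  -- Below k + r vertices the window contains no arc, so only the empty diagram can be counted.
  count-short : ∀ n → n < k + r → count n (P n) ≡ indicator (P n [])
  count-short n n<k+r =
    trans (countSublists-filterOn (ArcOn n) (inWindow k r n) (P n) (allArcs n) (P⇒inWindow n) (allArcs-ArcOn n))
      (trans (cong (countSublists (P n)) (Listₚ.filter-none _ (All.tabulate (λ e∈ → outside (∈-allArcs⁻ e∈)))))
             (countSublists-[] (P n)))
    where
    outside : ∀ {e} → ArcOn n e → ¬ T (inWindow k r n e)
    outside {i , j} (1≤i , i<j , j≤n) w =
      let k<i = <ᵇ⁻ (T-∧⁻ˡ w)
          j≤n∸r = ≤ᵇ⁻ (T-∧⁻ʳ {k <ᵇ i} w)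
          r<n : r < n
          r<n = m∸n≢0⇒n<m (λ e → <⇒≱ (subst (0 <_) e (≤-trans (≤-trans 1≤i (<⇒≤ i<j)) j≤n∸r)) ≤-refl)
      in <⇒≱ n<k+r (≤-trans (+-monoˡ-≤ r (≤-trans (<⇒≤ (<-trans k<i i<j)) j≤n∸r)) (≤-reflexive (m∸n+n≡m (<⇒≤ r<n))))

isOfType : ℕ → ℕ → ℕ → ℕ → Diagram → Bool
isOfType m a b n D = isRZ m n D ∧ hasType m a b n D

isOfType-↭ : ∀ m a b n {D D'} → D ↭ D' → isOfType m a b n D ≡ isOfType m a b n D'
isOfType-↭ m a b n {D} {D'} D↭D' =
  cong₂ _∧_ (isRZ-cong m n {D} {D'} (↭⇒SameProfile D↭D')) (hasType-cong m a b n {D} {D'} (↭⇒SameProfile D↭D'))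

z-countSublists : ∀ m n → countSublists (isRZ m n) (allArcs n) ≡ z m n
z-countSublists m zero = refl
z-countSublists m (suc n) = refl

g-countSublists : ∀ m n → countSublists (λ D → isRZ m n D ∧ (deg D 1 ≤ᵇ 1)) (allArcs n) ≡ g m n
g-countSublists m zero = refl
g-countSublists m (suc n) = refl

h-countSublists : ∀ m n → countSublists (λ D → isRZ m n D ∧ (deg D 1 ≤ᵇ 1) ∧ (deg D n ≤ᵇ 1)) (allArcs n) ≡ h m n
h-countSublists m zero = refl
h-countSublists m (suc n) = refl

z-countSublists-∧true : ∀ m n → countSublists (λ D → isRZ m n D ∧ true) (allArcs n) ≡ z m n
z-countSublists-∧true m n =
  trans (countSublists-ext _ (isRZ m n) (allArcs n) (λ D → ∧-identityʳ (isRZ m n D))) (z-countSublists m n)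

-- The boundary conditions of type (a , b) force the arcs into the window (k, n - r], and a shifted
-- stack on [q] meets them exactly when it satisfies the end condition X.
module TypeCount (m a b k r : ℕ) (2≤m : 2 ≤ m) (X : ℕ → Diagram → Bool)
  (arcsInWindow : ∀ n D → All (ArcOn n) D → ReducedZigzag m n D → BoundaryConditions m a b n D →
                  ∀ e → e ∈ D → T (inWindow k r n e))
  (X⇒boundary : ∀ n D → All (ArcOn n) D → ReducedZigzag m n D → T (X n D) →
                BoundaryConditions m a b (k + n + r) (shiftDiagram k D))
  (boundary⇒X : ∀ n D → All (ArcOn n) D → ReducedZigzag m n D →
                BoundaryConditions m a b (k + n + r) (shiftDiagram k D) → T (X n D)) where

  private
    ofType⇒inWindow : ∀ n D → All (ArcOn n) D → T (isOfType m a b n D) → All (λ e → T (inWindow k r n e)) D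
    ofType⇒inWindow n D arcs t =
      All.tabulate (λ {e} → arcsInWindow n D arcs (isRZ⇒ReducedZigzag m n D (T-∧⁻ˡ t))
                                         (hasType⇒BoundaryConditions 2≤m a b n D (T-∧⁻ʳ {isRZ m n D} t)) e)

    ofType-shift : ∀ n D → All (ArcOn n) D → isOfType m a b (k + n + r) (shiftDiagram k D) ≡ (isRZ m n D ∧ X n D)
    ofType-shift n D arcs = T-ext
      (λ t → let sD = ReducedZigzag-shift⁻ m k n r D arcs (isRZ⇒ReducedZigzag m N E (T-∧⁻ˡ t)) in
             T-∧⁺ (ReducedZigzag⇒isRZ m n D sD)
                  (boundary⇒X n D arcs sD (hasType⇒BoundaryConditions 2≤m a b N E (T-∧⁻ʳ {isRZ m N E} t))))
      (λ t → let sD = isRZ⇒ReducedZigzag m n D (T-∧⁻ˡ t)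
                 sE = ReducedZigzag-shift⁺ m k n r D arcs sD in
             T-∧⁺ (ReducedZigzag⇒isRZ m N E sE)
                  (BoundaryConditions⇒hasType 2≤m a b N E sE (X⇒boundary n D arcs sD (T-∧⁻ʳ {isRZ m n D} t))))
      where
      N = k + n + r
      E = shiftDiagram k D

    open WindowedCount k r (isOfType m a b) (λ q D → isRZ m q D ∧ X q D) (isOfType-↭ m a b) ofType⇒inWindow ofType-shift

  t-shifted : ∀ q → t m a b (k + r + q) ≡ countSublists (λ D → isRZ m q D ∧ X q D) (allArcs q)
  t-shifted q = trans (cong (t m a b) (xy∙z≈xz∙y k r q)) (count-shifted q)

  t-short : ∀ n → n < k + r → BoundaryConditions m a b n [] → t m a b n ≡ 1
  t-short n n<k+r c = trans (count-short n n<k+r)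
    (cong indicator (T⇒≡true (T-∧⁺ (ReducedZigzag⇒isRZ m n [] (ReducedZigzag-[] m n))
                                   (BoundaryConditions⇒hasType 2≤m a b n [] (ReducedZigzag-[] m n) c))))

  t-short-none : ∀ n → n < k + r → ¬ BoundaryConditions m a b n [] → t m a b n ≡ 0
  t-short-none n n<k+r ¬c = trans (count-short n n<k+r)
    (cong indicator (¬T⇒≡false (λ t → ¬c (hasType⇒BoundaryConditions 2≤m a b n [] (T-∧⁻ʳ {isRZ m n []} t)))))

-- Reflecting a diagram: vertex v of [n] becomes n + 1 - v

reflectArc : ℕ → Arc → Arc
reflectArc n (i , j) = (suc n ∸ j , suc n ∸ i)

reflectDiagram : ℕ → Diagram → Diagram
reflectDiagram n = map (reflectArc n)

∸≡ᵇ-swap : ∀ o x v → x ≤ o → v ≤ o → (o ∸ x ≡ᵇ v) ≡ (x ≡ᵇ o ∸ v)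
∸≡ᵇ-swap o x v x≤o v≤o = T-ext
  (λ t → ≡⇒≡ᵇ x (o ∸ v) (trans (sym (m∸[m∸n]≡n x≤o)) (cong (o ∸_) (≡ᵇ⇒≡ (o ∸ x) v t))))
  (λ t → ≡⇒≡ᵇ (o ∸ x) v (trans (cong (o ∸_) (≡ᵇ⇒≡ x (o ∸ v) t)) (m∸[m∸n]≡n v≤o)))

∸<ᵇ-swap : ∀ o x y → x ≤ o → y ≤ o → (o ∸ x <ᵇ o ∸ y) ≡ (y <ᵇ x)
∸<ᵇ-swap o x y x≤o y≤o =
  T-ext (λ t → <ᵇ⁺ (∸-cancelʳ-< {x} {y} {o} (<ᵇ⁻ t))) (λ t → <ᵇ⁺ (∸-monoʳ-< (<ᵇ⁻ t) x≤o))

∸[m+n]+n≡∸m : ∀ o i q → i + q ≤ o → (o ∸ (i + q)) + q ≡ o ∸ i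
∸[m+n]+n≡∸m o i q i+q≤o =
  trans (cong (_+ q) (sym (∸-+-assoc o i q))) (m∸n+n≡m (m+n≤o⇒m≤o∸n q (subst (_≤ o) (+-comm i q) i+q≤o)))

[o∸m]∸[o∸n]≡n∸m : ∀ o i j → i ≤ j → j ≤ o → (o ∸ i) ∸ (o ∸ j) ≡ j ∸ i
[o∸m]∸[o∸n]≡n∸m o i j i≤j j≤o = trans (cong (_∸ (o ∸ j)) split) (m+n∸m≡n (o ∸ j) (j ∸ i))
  where
  split : o ∸ i ≡ (o ∸ j) + (j ∸ i)
  split = trans (cong (_∸ i) (sym (m∸n+n≡m j≤o))) (+-∸-assoc (o ∸ j) i≤j)

∧-reverse : ∀ a b c → (a ∧ b ∧ c) ≡ (c ∧ b ∧ a)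
∧-reverse true true true = refl
∧-reverse true true false = refl
∧-reverse true false true = refl
∧-reverse true false false = refl
∧-reverse false true true = refl
∧-reverse false true false = refl
∧-reverse false false true = refl
∧-reverse false false false = refl

ArcOn-reflect : ∀ n {a} → ArcOn n a → ArcOn n (reflectArc n a)
ArcOn-reflect n {suc i , j} (_ , i<j , j≤n) = m<n⇒0<n∸m (s≤s j≤n) , ∸-monoʳ-< i<j (m≤n⇒m≤1+n j≤n) , m∸n≤m n i

reflectArc-involutive : ∀ n {a} → ArcOn n a → reflectArc n (reflectArc n a) ≡ a
reflectArc-involutive n {i , j} (_ , i<j , j≤n) =
  cong₂ _,_ (m∸[m∸n]≡n (≤-trans (<⇒≤ i<j) (m≤n⇒m≤1+n j≤n))) (m∸[m∸n]≡n (m≤n⇒m≤1+n j≤n))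

reflectDiagram-involutive : ∀ n {D} → All (ArcOn n) D → reflectDiagram n (reflectDiagram n D) ≡ D
reflectDiagram-involutive n [] = refl
reflectDiagram-involutive n (arc ∷ arcs) = cong₂ _∷_ (reflectArc-involutive n arc) (reflectDiagram-involutive n arcs)

allArcs-↭-reflect : ∀ n → allArcs n ↭ reflectDiagram n (allArcs n)
allArcs-↭-reflect n =
  ↭-from-Unique (allArcs-Unique n)
    (map⁺-injectiveOn (reflectArc n) (allArcs n)
       (λ {x} {y} x∈ y∈ e → trans (sym (reflectArc-involutive n (∈-allArcs⁻ x∈)))
                                  (trans (cong (reflectArc n) e) (reflectArc-involutive n (∈-allArcs⁻ y∈))))
       (allArcs-Unique n))
    (λ {a} a∈ → subst (_∈ reflectDiagram n (allArcs n)) (reflectArc-involutive n (∈-allArcs⁻ a∈))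
                      (∈-map⁺ (reflectArc n) (∈-allArcs⁺ (ArcOn-reflect n (∈-allArcs⁻ a∈)))))
    reflected∈
  where
  reflected∈ : ∀ {e} → e ∈ reflectDiagram n (allArcs n) → e ∈ allArcs n
  reflected∈ e∈ with ∈-map⁻ (reflectArc n) e∈
  ... | a , a∈ , refl = ∈-allArcs⁺ (ArcOn-reflect n (∈-allArcs⁻ a∈))

ld-reflect : ∀ n D v → All (ArcOn n) D → v ≤ suc n → ld (reflectDiagram n D) v ≡ rd D (suc n ∸ v)
ld-reflect n D v arcs v≤ = trans (countWhere-map (λ a → proj₂ a ≡ᵇ v) (reflectArc n) D)
  (countWhere-cong _ _ D (λ a a∈ → ∸≡ᵇ-swap (suc n) (proj₁ a) v (source≤ (All.lookup arcs a∈)) v≤))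
  where
  source≤ : ∀ {a} → ArcOn n a → proj₁ a ≤ suc n
  source≤ (_ , i<j , j≤n) = ≤-trans (<⇒≤ i<j) (m≤n⇒m≤1+n j≤n)

rd-reflect : ∀ n D v → All (ArcOn n) D → v ≤ suc n → rd (reflectDiagram n D) v ≡ ld D (suc n ∸ v)
rd-reflect n D v arcs v≤ = trans (countWhere-map (λ a → proj₁ a ≡ᵇ v) (reflectArc n) D)
  (countWhere-cong _ _ D (λ a a∈ → ∸≡ᵇ-swap (suc n) (proj₂ a) v (target≤ (All.lookup arcs a∈)) v≤))
  where
  target≤ : ∀ {a} → ArcOn n a → proj₂ a ≤ suc n
  target≤ (_ , _ , j≤n) = m≤n⇒m≤1+n j≤n

crossB-reflect : ∀ n a b → ArcOn n a → ArcOn n b → crossB (reflectArc n a) (reflectArc n b) ≡ crossB b a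
crossB-reflect n (i₁ , j₁) (i₂ , j₂) (_ , i₁<j₁ , j₁≤n) (_ , i₂<j₂ , j₂≤n)
  rewrite ∸<ᵇ-swap (suc n) j₁ j₂ (m≤n⇒m≤1+n j₁≤n) (m≤n⇒m≤1+n j₂≤n)
        | ∸<ᵇ-swap (suc n) j₂ i₁ (m≤n⇒m≤1+n j₂≤n) (m≤n⇒m≤1+n (≤-trans (<⇒≤ i₁<j₁) j₁≤n))
        | ∸<ᵇ-swap (suc n) i₁ i₂ (m≤n⇒m≤1+n (≤-trans (<⇒≤ i₁<j₁) j₁≤n)) (m≤n⇒m≤1+n (≤-trans (<⇒≤ i₂<j₂) j₂≤n))
  = ∧-reverse (j₂ <ᵇ j₁) (i₁ <ᵇ j₂) (i₂ <ᵇ i₁)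

module _ {m : ℕ} (1≤m : 1 ≤ m) where

  private
    +m∸1 : ∀ i → i + m ∸ 1 ≡ i + (m ∸ 1)
    +m∸1 i = +-∸-assoc i 1≤m

    1≤reflected : ∀ n v → v ≤ n → 1 ≤ suc n ∸ v
    1≤reflected n v v≤n = m<n⇒0<n∸m (s≤s v≤n)

    reflected≤n : ∀ n v → 1 ≤ v → suc n ∸ v ≤ n
    reflected≤n n (suc v) _ = m∸n≤m n v

  ReducedZigzag-reflect : ∀ n D → All (ArcOn n) D → ReducedZigzag m n D → ReducedZigzag m n (reflectDiagram n D)
  ReducedZigzag-reflect n D arcs s = mkReducedZigzag noCrossingR degreesR reachR gapR
    where
    R = reflectDiagram n D
    o = suc n
    noCrossingR : NoCrossing R
    noCrossingR a b a∈ b∈ c with ∈-map⁻ (reflectArc n) a∈ | ∈-map⁻ (reflectArc n) b∈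
    ... | a' , a'∈ , refl | b' , b'∈ , refl =
      noCrossing s b' a' b'∈ a'∈ (subst T (crossB-reflect n a' b' (All.lookup arcs a'∈) (All.lookup arcs b'∈)) c)
    degreesR : ZigzagDegrees n R
    degreesR v 1≤v v≤n
      rewrite ld-reflect n D v arcs (m≤n⇒m≤1+n v≤n) | rd-reflect n D v arcs (m≤n⇒m≤1+n v≤n)
      with degrees s (o ∸ v) (1≤reflected n v v≤n) (reflected≤n n v 1≤v)
    ... | deg≤2 , notBoth = subst (_≤ 2) (+-comm (ld D (o ∸ v)) (rd D (o ∸ v))) deg≤2 , (λ l r → notBoth r l)
    reachR : ReducedReach m n R
    reachR i 1≤i i≤n c =
      let x = i + (m ∸ 1)
          x≤n = subst (_≤ n) (+m∸1 i) c
          i' = o ∸ x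
          i'-reach : i' + m ∸ 1 ≡ o ∸ i
          i'-reach = trans (+m∸1 i') (∸[m+n]+n≡∸m o i (m ∸ 1) (m≤n⇒m≤1+n x≤n))
          reach' = reach s i' (1≤reflected n x x≤n) (reflected≤n n x (≤-trans 1≤i (m≤m+n i (m ∸ 1))))
                           (subst (_≤ n) (sym i'-reach) (reflected≤n n i 1≤i))
      in subst₂ (λ x y → x + y ≤ 2) (sym (ld-reflect n D i arcs (m≤n⇒m≤1+n i≤n)))
                (sym (trans (cong (rd R) (+m∸1 i)) (rd-reflect n D x arcs (m≤n⇒m≤1+n x≤n))))
                (subst (_≤ 2) (+-comm (ld D i') (rd D (o ∸ i))) (subst (λ y → ld D i' + rd D y ≤ 2) i'-reach reach'))
    gapR : ReducedGap m n R
    gapR i j 1≤i i≤n 1≤j j≤n i<j l r =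
      subst (m ∸ 1 ≤_) ([o∸m]∸[o∸n]≡n∸m o i j (<⇒≤ i<j) (m≤n⇒m≤1+n j≤n))
        (gap s (o ∸ j) (o ∸ i) (1≤reflected n j j≤n) (reflected≤n n j 1≤j) (1≤reflected n i i≤n) (reflected≤n n i 1≤i)
             (∸-monoʳ-< i<j (m≤n⇒m≤1+n j≤n))
             (subst (0 <_) (rd-reflect n D j arcs (m≤n⇒m≤1+n j≤n)) r) (subst (0 <_) (ld-reflect n D i arcs (m≤n⇒m≤1+n i≤n)) l))

  deg-reflect-last : ∀ n D → All (ArcOn (suc n)) D → deg (reflectDiagram (suc n) D) (suc n) ≡ deg D 1
  deg-reflect-last n D arcs
    rewrite ld-reflect (suc n) D (suc n) arcs (n≤1+n (suc n)) | rd-reflect (suc n) D (suc n) arcs (n≤1+n (suc n))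
          | m+n∸n≡m 1 (suc n) = +-comm (rd D 1) (ld D 1)

  -- Reflection turns the condition deg(n) ≤ 1 into deg(1) ≤ 1.
  lastDegree-countSublists : ∀ n → countSublists (λ D → isRZ m n D ∧ (deg D n ≤ᵇ 1)) (allArcs n) ≡ g m n
  lastDegree-countSublists n = begin
      countSublists LastOK (allArcs n)
    ≡⟨ countSublists-↭ LastOK LastOK-↭ (allArcs-↭-reflect n) ⟩
      countSublists LastOK (reflectDiagram n (allArcs n))
    ≡⟨ countSublists-map LastOK (reflectArc n) (allArcs n) ⟩
      countSublists (λ D → LastOK (reflectDiagram n D)) (allArcs n)
    ≡⟨ countSublists-congOn (ArcOn n) _ FirstOK (allArcs n) (reflect-LastOK n) (allArcs-ArcOn n) ⟩
      countSublists FirstOK (allArcs n)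
    ≡⟨ g-countSublists m n ⟩
      g m n
    ∎
    where
    open ≡-Reasoning
    LastOK FirstOK : Diagram → Bool
    LastOK D = isRZ m n D ∧ (deg D n ≤ᵇ 1)
    FirstOK D = isRZ m n D ∧ (deg D 1 ≤ᵇ 1)
    LastOK-↭ : ∀ {D D'} → D ↭ D' → LastOK D ≡ LastOK D'
    LastOK-↭ {D} {D'} D↭D' with ↭⇒SameProfile D↭D'
    ... | same@(sameLd , sameRd , _) =
      cong₂ _∧_ (isRZ-cong m n {D} {D'} same) (cong₂ (λ x y → (x + y) ≤ᵇ 1) (sameLd n) (sameRd n))
    reflect-LastOK : ∀ n D → All (ArcOn n) D → isRZ m n (reflectDiagram n D) ∧ (deg (reflectDiagram n D) n ≤ᵇ 1)
                                              ≡ (isRZ m n D ∧ (deg D 1 ≤ᵇ 1))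
    reflect-LastOK zero [] [] = refl
    reflect-LastOK zero (_ ∷ _) ((_ , i<j , j≤0) ∷ _) = ⊥-elim (<⇒≱ (<-≤-trans i<j j≤0) z≤n)
    reflect-LastOK (suc n) D arcs = T-ext
      (λ t → T-∧⁺ (ReducedZigzag⇒isRZ m (suc n) D
                     (subst (ReducedZigzag m (suc n)) (reflectDiagram-involutive (suc n) arcs)
                        (ReducedZigzag-reflect (suc n) (reflectDiagram (suc n) D) (reflected-arcs arcs)
                           (isRZ⇒ReducedZigzag m (suc n) _ (T-∧⁻ˡ t)))))
                  (subst (λ x → T (x ≤ᵇ 1)) (deg-reflect-last n D arcs) (T-∧⁻ʳ {isRZ m (suc n) (reflectDiagram (suc n) D)} t)))
      (λ t → T-∧⁺ (ReducedZigzag⇒isRZ m (suc n) _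
                     (ReducedZigzag-reflect (suc n) D arcs (isRZ⇒ReducedZigzag m (suc n) D (T-∧⁻ˡ t))))
                  (subst (λ x → T (x ≤ᵇ 1)) (sym (deg-reflect-last n D arcs)) (T-∧⁻ʳ {isRZ m (suc n) D} t)))
      where
      reflected-arcs : ∀ {D} → All (ArcOn (suc n)) D → All (ArcOn (suc n)) (reflectDiagram (suc n) D)
      reflected-arcs arcs = Allₚ.map⁺ (All.map (ArcOn-reflect (suc n)) arcs)

-- Coefficients of formal power series

module _ where

  open import Data.Integer.Base using (ℤ; +_; _-_) renaming (_+_ to _+ℤ_; _*_ to _*ℤ_)
  import Data.Integer.Properties as ℤₚ
  open import Data.Integer.Solver using (module +-*-Solver)
  open import Data.List.Base using (applyUpTo)

  partialSum : (ℕ → ℤ) → ℕ → ℤ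
  partialSum f n = sumℤ (applyUpTo f n)

  map-applyUpTo : ∀ {A B : Set} (f : A → B) (g : ℕ → A) n → map f (applyUpTo g n) ≡ applyUpTo (λ i → f (g i)) n
  map-applyUpTo f g zero = refl
  map-applyUpTo f g (suc n) = cong (f (g 0) ∷_) (map-applyUpTo f (λ i → g (suc i)) n)

  ⊛-partialSum : ∀ F G n → (F ⊛ G) n ≡ partialSum (λ k → F k *ℤ G (n ∸ k)) (suc n)
  ⊛-partialSum F G n = cong sumℤ (map-applyUpTo (λ k → F k *ℤ G (n ∸ k)) (λ i → i) (suc n))

  partialSum-cong : ∀ n (f g : ℕ → ℤ) → (∀ i → i < n → f i ≡ g i) → partialSum f n ≡ partialSum g n
  partialSum-cong zero f g h = refl
  partialSum-cong (suc n) f g h =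
    cong₂ _+ℤ_ (h 0 (s≤s z≤n)) (partialSum-cong n (λ i → f (suc i)) (λ i → g (suc i)) (λ i i< → h (suc i) (s≤s i<)))

  partialSum-zero : ∀ n (f : ℕ → ℤ) → (∀ i → i < n → f i ≡ + 0) → partialSum f n ≡ + 0
  partialSum-zero zero f h = refl
  partialSum-zero (suc n) f h rewrite h 0 (s≤s z≤n) =
    trans (ℤₚ.+-identityˡ _) (partialSum-zero n (λ i → f (suc i)) (λ i i< → h (suc i) (s≤s i<)))

  partialSum-single : ∀ n k (f : ℕ → ℤ) → k < n → (∀ i → i < n → i ≢ k → f i ≡ + 0) → partialSum f n ≡ f k
  partialSum-single (suc n) zero f _ h =
    trans (cong (f 0 +ℤ_) (partialSum-zero n (λ i → f (suc i)) (λ i i< → h (suc i) (s≤s i<) (λ ())))) (ℤₚ.+-identityʳ (f 0))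
  partialSum-single (suc n) (suc k) f (s≤s k<n) h rewrite h 0 (s≤s z≤n) (λ ()) =
    trans (ℤₚ.+-identityˡ _)
          (partialSum-single n k (λ i → f (suc i)) k<n (λ i i< i≢k → h (suc i) (s≤s i<) (λ e → i≢k (suc-injective e))))

  partialSum-- : ∀ n (f g : ℕ → ℤ) → partialSum (λ i → f i - g i) n ≡ partialSum f n - partialSum g n
  partialSum-- zero f g = refl
  partialSum-- (suc n) f g =
    trans (cong ((f 0 - g 0) +ℤ_) (partialSum-- n (λ i → f (suc i)) (λ i → g (suc i))))
          (sumOfDifferences (f 0) (g 0) (partialSum (λ i → f (suc i)) n) (partialSum (λ i → g (suc i)) n))
    where
    open +-*-Solver
    sumOfDifferences : ∀ a b c d → (a - b) +ℤ (c - d) ≡ (a +ℤ c) - (b +ℤ d)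
    sumOfDifferences = solve 4 (λ a b c d → (a :- b) :+ (c :- d) := (a :+ c) :- (b :+ d)) refl

  X^-off : ∀ c i → i ≢ c → X^ c i ≡ + 0
  X^-off c i i≢c rewrite ≢⇒≡ᵇ-false i≢c = refl

  X^-on : ∀ c → X^ c c ≡ + 1
  X^-on c rewrite ≡ᵇ-refl c = refl

  X^-shift : ∀ a c q → X^ (a + c) (a + q) ≡ X^ c q
  X^-shift a c q rewrite ≡ᵇ-cancelˡ-+ a q c = refl

  one≗X^0 : ∀ q → one q ≡ X^ 0 q
  one≗X^0 zero = refl
  one≗X^0 (suc q) = refl

  indicator-≤ : ∀ {c n} → c ≤ n → indicator (c ≤ᵇ n) ≡ 1
  indicator-≤ c≤n rewrite T⇒≡true (≤ᵇ⁺ c≤n) = refl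

  indicator-> : ∀ {c n} → n < c → indicator (c ≤ᵇ n) ≡ 0
  indicator-> {c} {n} n<c rewrite ¬T⇒≡false {c ≤ᵇ n} (λ t → <⇒≱ n<c (≤ᵇ⁻ t)) = refl

  partialSum-X^ : ∀ c n → partialSum (X^ c) (suc n) ≡ + indicator (c ≤ᵇ n)
  partialSum-X^ c n with c ≤? n
  ... | yes c≤n rewrite indicator-≤ c≤n =
    trans (partialSum-single (suc n) c (X^ c) (s≤s c≤n) (λ i _ i≢c → X^-off c i i≢c)) (X^-on c)
  ... | no c≰n rewrite indicator-> (≰⇒> c≰n) =
    partialSum-zero (suc n) (X^ c) (λ i i< → X^-off c i (λ e → c≰n (subst (_≤ n) e (≤-pred i<))))

  X^⊛-below : ∀ c F n → n < c → (X^ c ⊛ F) n ≡ + 0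
  X^⊛-below c F n n<c = trans (⊛-partialSum (X^ c) F n)
    (partialSum-zero (suc n) _ (λ i i< → cong (_*ℤ F (n ∸ i)) (X^-off c i (λ e → <⇒≱ n<c (subst (_≤ n) e (≤-pred i<))))))

  X^⊛-shift : ∀ c F q → (X^ c ⊛ F) (c + q) ≡ F q
  X^⊛-shift c F q = begin
      (X^ c ⊛ F) (c + q)
    ≡⟨ ⊛-partialSum (X^ c) F (c + q) ⟩
      partialSum (λ k → X^ c k *ℤ F (c + q ∸ k)) (suc (c + q))
    ≡⟨ partialSum-single (suc (c + q)) c _ (s≤s (m≤m+n c q)) (λ i _ i≢c → cong (_*ℤ F (c + q ∸ i)) (X^-off c i i≢c)) ⟩
      X^ c c *ℤ F (c + q ∸ c)
    ≡⟨ cong₂ _*ℤ_ (X^-on c) (cong F (m+n∸m≡n c q)) ⟩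
      + 1 *ℤ F q
    ≡⟨ ℤₚ.*-identityˡ (F q) ⟩
      F q
    ∎
    where open ≡-Reasoning

  ⊛inv1-X : ∀ F n → (F ⊛ inv1-X) n ≡ partialSum F (suc n)
  ⊛inv1-X F n = trans (⊛-partialSum F inv1-X n) (partialSum-cong (suc n) _ F (λ i _ → ℤₚ.*-identityʳ (F i)))

  geometricPrefix-coeff : ∀ b n → ((one ⊖ X^ b) ⊛ inv1-X) n ≡ + 1 - + indicator (b ≤ᵇ n)
  geometricPrefix-coeff b n = begin
      ((one ⊖ X^ b) ⊛ inv1-X) n
    ≡⟨ ⊛inv1-X (one ⊖ X^ b) n ⟩
      partialSum (one ⊖ X^ b) (suc n)
    ≡⟨ partialSum-- (suc n) one (X^ b) ⟩
      partialSum one (suc n) - partialSum (X^ b) (suc n)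
    ≡⟨ cong₂ _-_ (cong (+ 1 +ℤ_) (partialSum-zero n (λ i → one (suc i)) (λ _ _ → refl))) (partialSum-X^ b n) ⟩
      + 1 - + indicator (b ≤ᵇ n)
    ∎
    where open ≡-Reasoning

  X^⊛geometricPrefix : ∀ a b i → (X^ a ⊛ (one ⊖ X^ b)) i ≡ X^ a i - X^ (a + b) i
  X^⊛geometricPrefix a b i with a ≤? i
  ... | no a≰i =
    trans (X^⊛-below a (one ⊖ X^ b) i (≰⇒> a≰i))
          (sym (cong₂ _-_ (X^-off a i (λ e → a≰i (≤-reflexive (sym e))))
                          (X^-off (a + b) i (λ e → a≰i (subst (a ≤_) (sym e) (m≤m+n a b))))))
  ... | yes a≤i = subst (λ j → (X^ a ⊛ (one ⊖ X^ b)) j ≡ X^ a j - X^ (a + b) j) (m+[n∸m]≡n a≤i)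
    (trans (X^⊛-shift a (one ⊖ X^ b) (i ∸ a))
       (cong₂ _-_ (trans (one≗X^0 (i ∸ a)) (trans (sym (X^-shift a 0 (i ∸ a))) (cong (λ c → X^ c (a + (i ∸ a))) (+-identityʳ a))))
                  (sym (X^-shift a b (i ∸ a)))))

  shiftedGeometricPrefix-coeff : ∀ a b n →
    (X^ a ⊛ (one ⊖ X^ b) ⊛ inv1-X) n ≡ + indicator (a ≤ᵇ n) - + indicator (a + b ≤ᵇ n)
  shiftedGeometricPrefix-coeff a b n = begin
      (X^ a ⊛ (one ⊖ X^ b) ⊛ inv1-X) n
    ≡⟨ ⊛inv1-X (X^ a ⊛ (one ⊖ X^ b)) n ⟩
      partialSum (X^ a ⊛ (one ⊖ X^ b)) (suc n)
    ≡⟨ partialSum-cong (suc n) _ (λ i → X^ a i - X^ (a + b) i) (λ i _ → X^⊛geometricPrefix a b i) ⟩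
      partialSum (λ i → X^ a i - X^ (a + b) i) (suc n)
    ≡⟨ partialSum-- (suc n) (X^ a) (X^ (a + b)) ⟩
      partialSum (X^ a) (suc n) - partialSum (X^ (a + b)) (suc n)
    ≡⟨ cong₂ _-_ (partialSum-X^ a n) (partialSum-X^ (a + b) n) ⟩
      + indicator (a ≤ᵇ n) - + indicator (a + b ≤ᵇ n)
    ∎
    where open ≡-Reasoning

  window-series : ∀ (f F : ℕ → ℕ) (G : FPS) a c → a ≤ c →
    (∀ n → G n ≡ + indicator (a ≤ᵇ n) - + indicator (c ≤ᵇ n)) →
    (∀ n → n < a → f n ≡ 0) → (∀ n → a ≤ n → n < c → f n ≡ 1) → (∀ q → f (c + q) ≡ F q) →
    series f ≐ G ⊕ X^ c ⊛ series F
  window-series f F G a c a≤c G-coeff below inside above n with n <? a | n <? c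
  ... | yes n<a | _
    rewrite below n n<a | G-coeff n | indicator-> n<a | indicator-> (<-≤-trans n<a a≤c)
          | X^⊛-below c (series F) n (<-≤-trans n<a a≤c) = refl
  ... | no n≮a | yes n<c
    rewrite inside n (≮⇒≥ n≮a) n<c | G-coeff n | indicator-≤ (≮⇒≥ n≮a) | indicator-> n<c
          | X^⊛-below c (series F) n n<c = refl
  ... | no _ | no n≮c = subst (λ n → series f n ≡ (G ⊕ X^ c ⊛ series F) n) (m+[n∸m]≡n (≮⇒≥ n≮c)) (beyond (n ∸ c))
    where
    beyond : ∀ q → + f (c + q) ≡ G (c + q) +ℤ (X^ c ⊛ series F) (c + q)
    beyond q rewrite G-coeff (c + q) | indicator-≤ (≤-trans a≤c (m≤m+n c q)) | indicator-≤ (m≤m+n c q)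
                   | X^⊛-shift c (series F) q | above q = sym (ℤₚ.+-identityˡ (+ F q))

-- The six boundary types, for m = p + 2

module BoundaryTypes (p : ℕ) where

  m : ℕ
  m = suc (suc p)

  private
    2≤m : 2 ≤ m
    2≤m = s≤s (s≤s z≤n)

    +m∸1 : ∀ i → i + m ∸ 1 ≡ i + suc p
    +m∸1 i = +-∸-assoc i (s≤s z≤n)

    ≤-rightEnd : ∀ {n j} → j ≤ n → suc p ≤ suc n ∸ j → j + p ≤ n
    ≤-rightEnd {n} {j} j≤n gap =
      ≤-pred (subst (_≤ suc n) (cong suc (+-comm p j)) (m≤o∸n⇒m+n≤o (suc p) (m≤n⇒m≤1+n j≤n) gap))

    +suc-cancel : ∀ i x → i + suc p ≡ suc (x + p) → i ≡ x
    +suc-cancel i x e = +-cancelʳ-≡ p i x (suc-injective (trans (sym (+-suc i p)) e))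

  arcEnd-bound : ∀ {a b n D i j} → 0 < b → All (ArcOn n) D → BoundaryConditions m a b n D → (i , j) ∈ D → j + p ≤ n
  arcEnd-bound {D = D} {i} {j} 0<b arcs c e∈ with All.lookup arcs e∈
  ... | 1≤i , i<j , j≤n = ≤-rightEnd j≤n (rightGap c 0<b j (≤-trans 1≤i (<⇒≤ i<j)) j≤n (ld-pos D (i , j) e∈))

  arcStart-bound : ∀ {a b n D i j} → 0 < a → All (ArcOn n) D → BoundaryConditions m a b n D → (i , j) ∈ D → p < i
  arcStart-bound {D = D} {i} {j} 0<a arcs c e∈ with All.lookup arcs e∈
  ... | 1≤i , i<j , j≤n = leftGap c 0<a i 1≤i (≤-trans (<⇒≤ i<j) j≤n) (rd-pos D (i , j) e∈)

  -- With a = 2 the vertex m - 1 cannot carry a right arc, by condition (i) at vertex 0.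
  arcStart-bound₂ : ∀ {b n D i j} → All (ArcOn n) D → BoundaryConditions m 2 b n D → (i , j) ∈ D → suc p < i
  arcStart-bound₂ {D = D} {i} {j} arcs c e∈ with All.lookup arcs e∈
  ... | 1≤i , i<j , j≤n = ≤∧≢⇒< (arcStart-bound (s≤s z≤n) arcs c e∈) 1+p≢i
    where
    1+p≢i : suc p ≢ i
    1+p≢i refl = <⇒≱ (+-monoʳ-< 2 (rd-pos D (i , j) e∈))
                     (subst (2 + rd D (suc p) ≤_) (+-identityʳ 2) (leftReach c (≤-trans (<⇒≤ i<j) j≤n)))

  leftGap-shift : ∀ k {a} n r {D} → All (ArcOn n) D → p ≤ k →
                  0 < a → ∀ j → 1 ≤ j → j ≤ k + n + r → 0 < rd (shiftDiagram k D) j → suc p ≤ j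
  leftGap-shift k n r {D} arcs p≤k _ j _ _ rj with shiftPosition k j
  ... | inPrefix j≤k rewrite rd-shift-prefix k D j arcs j≤k = ⊥-elim (<-irrefl refl rj)
  ... | shifted w 1≤w refl = ≤-trans (s≤s p≤k) (subst (_≤ k + w) (sym (+-comm 1 k)) (+-monoʳ-≤ k 1≤w))

  rightGap-shift : ∀ k {b} n r {D} → All (ArcOn n) D → p ≤ r →
                   0 < b → ∀ i → 1 ≤ i → i ≤ k + n + r → 0 < ld (shiftDiagram k D) i → suc p ≤ suc (k + n + r) ∸ i
  rightGap-shift k n r {D} arcs p≤r _ i _ _ li with shiftPosition k i
  ... | inPrefix i≤k rewrite ld-shift-prefix k D i arcs i≤k = ⊥-elim (<-irrefl refl li)
  ... | shifted w 1≤w refl rewrite ld-shift k D w =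
    m+n≤o⇒m≤o∸n (suc p) (s≤s (subst (_≤ k + n + r) (+-comm (k + w) p)
                                     (+-mono-≤ (+-monoʳ-≤ k (proj₂ (ld-pos⇒bounds arcs li))) p≤r)))

  crossGap-shift : ∀ k n r → p ≤ k → suc p ≤ suc (k + n + r)
  crossGap-shift k n r p≤k = s≤s (≤-trans p≤k (≤-trans (m≤m+n k n) (m≤m+n (k + n) r)))

  rd-shift-first : ∀ {n D} → All (ArcOn n) D → rd (shiftDiagram p D) (suc p) ≡ deg D 1
  rd-shift-first {D = D} arcs =
    trans (cong (rd (shiftDiagram p D)) (+-comm 1 p)) (trans (rd-shift p D 1) (sym (deg-first arcs)))

  ld-shift-last : ∀ k {n D} → All (ArcOn n) D → ld (shiftDiagram k D) (k + n) ≡ deg D n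
  ld-shift-last k {n} {D} arcs = trans (ld-shift k D n) (sym (deg-last arcs))

  leftReach-from-firstDegree : ∀ n r {D} → All (ArcOn n) D → deg D 1 ≤ 1 →
    suc p ≤ p + n + r → 1 + rd (shiftDiagram p D) (suc p) ≤ 2
  leftReach-from-firstDegree n r arcs first≤1 _ = s≤s (subst (_≤ 1) (sym (rd-shift-first arcs)) first≤1)

  firstDegree-from-leftReach : ∀ n r {D} → All (ArcOn n) D →
    (suc p ≤ p + n + r → 1 + rd (shiftDiagram p D) (suc p) ≤ 2) → deg D 1 ≤ 1
  firstDegree-from-leftReach zero r arcs _ = ≤-trans (≤-reflexive (trans (deg-first arcs) (rd-outside arcs (inj₂ z≤n)))) z≤n
  firstDegree-from-leftReach (suc n) r arcs leftReach′ =
    subst (_≤ 1) (rd-shift-first arcs)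
          (≤-pred (leftReach′ (subst (_≤ p + suc n + r) (sym (+-comm 1 p))
                                     (≤-trans (+-monoʳ-≤ p (s≤s z≤n)) (m≤m+n (p + suc n) r)))))

  rightReach-from-lastDegree : ∀ k n {D} → All (ArcOn n) D → deg D n ≤ 1 →
    ∀ i → 1 ≤ i → i ≤ k + n + p → i + m ∸ 1 ≡ suc (k + n + p) → ld (shiftDiagram k D) i + 1 ≤ 2
  rightReach-from-lastDegree k n arcs last≤1 i _ _ e with +suc-cancel i (k + n) (trans (sym (+m∸1 i)) e)
  ... | refl = +-monoˡ-≤ 1 (subst (_≤ 1) (sym (ld-shift-last k arcs)) last≤1)

  lastDegree-from-rightReach : ∀ k n {D} → All (ArcOn n) D → 1 ≤ k + n →
    (∀ i → 1 ≤ i → i ≤ k + n + p → i + m ∸ 1 ≡ suc (k + n + p) → ld (shiftDiagram k D) i + 1 ≤ 2) → deg D n ≤ 1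
  lastDegree-from-rightReach k n arcs 1≤k+n rightReach′ =
    +-cancelʳ-≤ 1 _ 1 (subst (λ x → x + 1 ≤ 2) (ld-shift-last k arcs)
                             (rightReach′ (k + n) 1≤k+n (m≤m+n (k + n) p) (trans (+m∸1 (k + n)) (+-suc (k + n) p))))

  leftReach₂ : ∀ n r {D} → All (ArcOn n) D → suc p ≤ suc p + n + r → 2 + rd (shiftDiagram (suc p) D) (suc p) ≤ 2
  leftReach₂ n r {D} arcs _ rewrite rd-shift-prefix (suc p) D (suc p) arcs ≤-refl = ≤-refl

  crossReach₂ : ∀ {b} n r → suc p ≡ suc (suc p + n + r) → 2 + b ≤ 2
  crossReach₂ n r e = ⊥-elim (<-irrefl (suc-injective e) (s≤s (≤-trans (m≤m+n p n) (m≤m+n (p + n) r))))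

  rightReach₀ : ∀ k n {D} → All (ArcOn n) D → ZigzagDegrees n D → ∀ i → ld (shiftDiagram k D) i + 0 ≤ 2
  rightReach₀ k n arcs zz i = subst (_≤ 2) (sym (+-identityʳ _)) (ld-shift≤2 k arcs zz i)

  type00 : ∀ n → t m 0 0 n ≡ z m n
  type00 n = trans (countSublists-congOn (ArcOn n) (isOfType m 0 0 n) (isRZ m n) (allArcs n) ofType≡isRZ (allArcs-ArcOn n))
                   (z-countSublists m n)
    where
    ofType≡isRZ : ∀ D → All (ArcOn n) D → isOfType m 0 0 n D ≡ isRZ m n D
    ofType≡isRZ D arcs = T-ext T-∧⁻ˡ (λ t → T-∧⁺ t (BoundaryConditions⇒hasType 2≤m 0 0 n D (s t) (conditions t)))
      where
      s = isRZ⇒ReducedZigzag m n D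
      conditions : ∀ t → BoundaryConditions m 0 0 n D
      conditions t = mkBoundaryConditions (λ _ → rd≤2 arcs (degrees (s t)) (suc p)) (λ _ → z≤n)
                       (λ i _ _ _ → subst (_≤ 2) (sym (+-identityʳ _)) (ld≤2 arcs (degrees (s t)) i)) (λ ()) (λ ()) (λ ())

  private
    inWindow₁₀ : ∀ n D → All (ArcOn n) D → ReducedZigzag m n D → BoundaryConditions m 1 0 n D →
                 ∀ e → e ∈ D → T (inWindow p 0 n e)
    inWindow₁₀ n D arcs _ c (i , j) e∈ = inWindow-from-bounds p 0 n (arcStart-bound (s≤s z≤n) arcs c e∈)
      (subst (_≤ n) (sym (+-identityʳ j)) (proj₂ (proj₂ (All.lookup arcs e∈))))

    boundary₁₀ : ∀ n D → All (ArcOn n) D → ReducedZigzag m n D → T (deg D 1 ≤ᵇ 1) →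
                 BoundaryConditions m 1 0 (p + n + 0) (shiftDiagram p D)
    boundary₁₀ n D arcs s first≤1 =
      mkBoundaryConditions (leftReach-from-firstDegree n 0 arcs (≤ᵇ⁻ first≤1)) (λ _ → s≤s z≤n)
        (λ i _ _ _ → rightReach₀ p n arcs (degrees s) i) (leftGap-shift p n 0 arcs ≤-refl) (λ ()) (λ _ ())

    firstDegree₁₀ : ∀ n D → All (ArcOn n) D → ReducedZigzag m n D →
                    BoundaryConditions m 1 0 (p + n + 0) (shiftDiagram p D) → T (deg D 1 ≤ᵇ 1)
    firstDegree₁₀ n D arcs _ c = ≤ᵇ⁺ (firstDegree-from-leftReach n 0 arcs (leftReach c))

    module T₁₀ = TypeCount m 1 0 p 0 2≤m (λ _ D → deg D 1 ≤ᵇ 1) inWindow₁₀ boundary₁₀ firstDegree₁₀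

    inWindow₁₁ : ∀ n D → All (ArcOn n) D → ReducedZigzag m n D → BoundaryConditions m 1 1 n D →
                 ∀ e → e ∈ D → T (inWindow p p n e)
    inWindow₁₁ n D arcs _ c (i , j) e∈ =
      inWindow-from-bounds p p n (arcStart-bound (s≤s z≤n) arcs c e∈) (arcEnd-bound (s≤s z≤n) arcs c e∈)

    EndDegrees : ℕ → Diagram → Bool
    EndDegrees n D = (deg D 1 ≤ᵇ 1) ∧ (deg D n ≤ᵇ 1)

    boundary₁₁ : ∀ n D → All (ArcOn n) D → ReducedZigzag m n D → T (EndDegrees n D) →
                 BoundaryConditions m 1 1 (p + n + p) (shiftDiagram p D)
    boundary₁₁ n D arcs s ends =
      mkBoundaryConditions (leftReach-from-firstDegree n p arcs (≤ᵇ⁻ (T-∧⁻ˡ ends))) (λ _ → ≤-refl)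
        (rightReach-from-lastDegree p n arcs (≤ᵇ⁻ (T-∧⁻ʳ {deg D 1 ≤ᵇ 1} ends)))
        (leftGap-shift p n p arcs ≤-refl) (rightGap-shift p n p arcs ≤-refl) (λ _ _ → crossGap-shift p n p ≤-refl)

    endDegrees₁₁ : ∀ n D → All (ArcOn n) D → ReducedZigzag m n D →
                   BoundaryConditions m 1 1 (p + n + p) (shiftDiagram p D) → T (EndDegrees n D)
    endDegrees₁₁ zero D arcs _ c = T-∧⁺ (≤ᵇ⁺ (firstDegree-from-leftReach zero p arcs (leftReach c)))
      (≤ᵇ⁺ (≤-trans (≤-reflexive (trans (deg-last arcs) (ld-outside arcs (inj₁ (s≤s z≤n))))) z≤n))
    endDegrees₁₁ (suc n) D arcs _ c = T-∧⁺ (≤ᵇ⁺ (firstDegree-from-leftReach (suc n) p arcs (leftReach c)))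
      (≤ᵇ⁺ (lastDegree-from-rightReach p (suc n) arcs (≤-trans (s≤s z≤n) (m≤n+m (suc n) p)) (rightReach c)))

    module T₁₁ = TypeCount m 1 1 p p 2≤m EndDegrees inWindow₁₁ boundary₁₁ endDegrees₁₁

    inWindow₂₀ : ∀ n D → All (ArcOn n) D → ReducedZigzag m n D → BoundaryConditions m 2 0 n D →
                 ∀ e → e ∈ D → T (inWindow (suc p) 0 n e)
    inWindow₂₀ n D arcs _ c (i , j) e∈ = inWindow-from-bounds (suc p) 0 n (arcStart-bound₂ arcs c e∈)
      (subst (_≤ n) (sym (+-identityʳ j)) (proj₂ (proj₂ (All.lookup arcs e∈))))

    boundary₂₀ : ∀ n D → All (ArcOn n) D → ReducedZigzag m n D → T true →
                 BoundaryConditions m 2 0 (suc p + n + 0) (shiftDiagram (suc p) D)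
    boundary₂₀ n D arcs s _ =
      mkBoundaryConditions (leftReach₂ n 0 arcs) (crossReach₂ n 0) (λ i _ _ _ → rightReach₀ (suc p) n arcs (degrees s) i)
        (leftGap-shift (suc p) n 0 arcs (n≤1+n p)) (λ ()) (λ _ ())

    module T₂₀ = TypeCount m 2 0 (suc p) 0 2≤m (λ _ _ → true) inWindow₂₀ boundary₂₀ (λ _ _ _ _ _ → tt)

    inWindow₂₁ : ∀ n D → All (ArcOn n) D → ReducedZigzag m n D → BoundaryConditions m 2 1 n D →
                 ∀ e → e ∈ D → T (inWindow (suc p) p n e)
    inWindow₂₁ n D arcs _ c (i , j) e∈ =
      inWindow-from-bounds (suc p) p n (arcStart-bound₂ arcs c e∈) (arcEnd-bound (s≤s z≤n) arcs c e∈)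

    boundary₂₁ : ∀ n D → All (ArcOn n) D → ReducedZigzag m n D → T (deg D n ≤ᵇ 1) →
                 BoundaryConditions m 2 1 (suc p + n + p) (shiftDiagram (suc p) D)
    boundary₂₁ n D arcs s last≤1 =
      mkBoundaryConditions (leftReach₂ n p arcs) (crossReach₂ n p) (rightReach-from-lastDegree (suc p) n arcs (≤ᵇ⁻ last≤1))
        (leftGap-shift (suc p) n p arcs (n≤1+n p)) (rightGap-shift (suc p) n p arcs ≤-refl)
        (λ _ _ → crossGap-shift (suc p) n p (n≤1+n p))

    lastDegree₂₁ : ∀ n D → All (ArcOn n) D → ReducedZigzag m n D →
                   BoundaryConditions m 2 1 (suc p + n + p) (shiftDiagram (suc p) D) → T (deg D n ≤ᵇ 1)
    lastDegree₂₁ n D arcs _ c = ≤ᵇ⁺ (lastDegree-from-rightReach (suc p) n arcs (s≤s z≤n) (rightReach c))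

    module T₂₁ = TypeCount m 2 1 (suc p) p 2≤m (λ n D → deg D n ≤ᵇ 1) inWindow₂₁ boundary₂₁ lastDegree₂₁

    -- With b = 2 an arc ending at n + 2 - m would violate condition (i) at that vertex.
    inWindow₂₂ : ∀ n D → All (ArcOn n) D → ReducedZigzag m n D → BoundaryConditions m 2 2 n D →
                 ∀ e → e ∈ D → T (inWindow (suc p) (suc p) n e)
    inWindow₂₂ n D arcs _ c (i , j) e∈ with All.lookup arcs e∈
    ... | 1≤i , i<j , j≤n = inWindow-from-bounds (suc p) (suc p) n (arcStart-bound₂ arcs c e∈) end<
      where
      end< : j + suc p ≤ n
      end< with m≤n⇒m<n∨m≡n (arcEnd-bound (s≤s z≤n) arcs c e∈)
      ... | inj₁ j+p<n = subst (_≤ n) (sym (+-suc j p)) j+p<n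
      ... | inj₂ j+p≡n = ⊥-elim (<⇒≱ (+-monoˡ-< 2 (ld-pos D (i , j) e∈))
                          (rightReach c j (≤-trans 1≤i (<⇒≤ i<j)) j≤n (trans (+m∸1 j) (trans (+-suc j p) (cong suc j+p≡n)))))

    boundary₂₂ : ∀ n D → All (ArcOn n) D → ReducedZigzag m n D → T true →
                 BoundaryConditions m 2 2 (suc p + n + suc p) (shiftDiagram (suc p) D)
    boundary₂₂ n D arcs s _ =
      mkBoundaryConditions (leftReach₂ n (suc p) arcs) (crossReach₂ n (suc p)) rightReach′
        (leftGap-shift (suc p) n (suc p) arcs (n≤1+n p)) (rightGap-shift (suc p) n (suc p) arcs (n≤1+n p))
        (λ _ _ → crossGap-shift (suc p) n (suc p) (n≤1+n p))
      where
      rightReach′ : ∀ i → 1 ≤ i → i ≤ suc p + n + suc p → i + m ∸ 1 ≡ suc (suc p + n + suc p) →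
                    ld (shiftDiagram (suc p) D) i + 2 ≤ 2
      rightReach′ i _ _ e with +suc-cancel i (suc (suc p + n)) (trans (trans (sym (+m∸1 i)) e) (cong suc (+-suc (suc p + n) p)))
      ... | refl rewrite sym (+-suc (suc p) n) | ld-shift (suc p) D (suc n) | ld-outside {n} {D} {suc n} arcs (inj₂ ≤-refl) = ≤-refl

    module T₂₂ = TypeCount m 2 2 (suc p) (suc p) 2≤m (λ _ _ → true) inWindow₂₂ boundary₂₂ (λ _ _ _ _ _ → tt)

  no-empty₂ : ∀ {b n} → 0 < b → n ≤ p → ¬ BoundaryConditions m 2 b n []
  no-empty₂ {b} 0<b n≤p c with m≤n⇒m<n∨m≡n n≤p
  ... | inj₁ n<p = <⇒≱ n<p (≤-pred (crossGap c (s≤s z≤n) 0<b))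
  ... | inj₂ refl = <⇒≱ (subst (_< 2 + b) (+-identityʳ 2) (+-monoʳ-< 2 0<b)) (crossReach c refl)

  type00-series : Tser m 0 0 ≐ Zser m
  type00-series n = cong ℤ.+_ (type00 n)

  type10-series : Tser m 1 0 ≐ (one ⊖ X^ p) ⊛ inv1-X ⊕ X^ p ⊛ Gser m
  type10-series = window-series (t m 1 0) (g m) _ 0 p z≤n (geometricPrefix-coeff p) (λ _ ()) inside above
    where
    inside : ∀ n → 0 ≤ n → n < p → t m 1 0 n ≡ 1
    inside n _ n<p = T₁₀.t-short n (subst (n <_) (sym (+-identityʳ p)) n<p)
                       (BoundaryConditions-[] (s≤s z≤n) z≤n (λ _ → s≤s z≤n) (λ _ ()))
    above : ∀ q → t m 1 0 (p + q) ≡ g m q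
    above q = trans (cong (λ k → t m 1 0 (k + q)) (sym (+-identityʳ p))) (trans (T₁₀.t-shifted q) (g-countSublists m q))

  type11-series : ∀ c → c ≡ p + p → Tser m 1 1 ≐ X^ p ⊛ (one ⊖ X^ p) ⊛ inv1-X ⊕ X^ c ⊛ Hser m
  type11-series .(p + p) refl =
    window-series (t m 1 1) (h m) _ p (p + p) (m≤m+n p p) (shiftedGeometricPrefix-coeff p p) below inside above
    where
    below : ∀ n → n < p → t m 1 1 n ≡ 0
    below n n<p = T₁₁.t-short-none n (<-≤-trans n<p (m≤m+n p p))
                                   (λ c → <⇒≱ n<p (≤-pred (crossGap c (s≤s z≤n) (s≤s z≤n))))
    inside : ∀ n → p ≤ n → n < p + p → t m 1 1 n ≡ 1
    inside n p≤n n<2p =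
      T₁₁.t-short n n<2p (BoundaryConditions-[] (s≤s z≤n) (s≤s z≤n) (λ _ → ≤-refl) (λ _ _ → s≤s p≤n))
    above : ∀ q → t m 1 1 (p + p + q) ≡ h m q
    above q = trans (T₁₁.t-shifted q) (h-countSublists m q)

  type20-series : Tser m 2 0 ≐ (one ⊖ X^ (suc p)) ⊛ inv1-X ⊕ X^ (suc p) ⊛ Zser m
  type20-series = window-series (t m 2 0) (z m) _ 0 (suc p) z≤n (geometricPrefix-coeff (suc p)) (λ _ ()) inside above
    where
    inside : ∀ n → 0 ≤ n → n < suc p → t m 2 0 n ≡ 1
    inside n _ n≤p = T₂₀.t-short n (subst (n <_) (sym (+-identityʳ (suc p))) n≤p)
                       (BoundaryConditions-[] ≤-refl z≤n (λ _ → ≤-refl) (λ _ ()))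
    above : ∀ q → t m 2 0 (suc p + q) ≡ z m q
    above q = trans (cong (λ k → t m 2 0 (k + q)) (sym (+-identityʳ (suc p))))
                    (trans (T₂₀.t-shifted q) (z-countSublists-∧true m q))

  type21-series : ∀ c → c ≡ suc p + p → Tser m 2 1 ≐ X^ (suc p) ⊛ (one ⊖ X^ p) ⊛ inv1-X ⊕ X^ c ⊛ Gser m
  type21-series .(suc p + p) refl =
    window-series (t m 2 1) (g m) _ (suc p) (suc p + p) (m≤m+n (suc p) p) (shiftedGeometricPrefix-coeff (suc p) p)
                  below inside above
    where
    below : ∀ n → n < suc p → t m 2 1 n ≡ 0
    below n (s≤s n≤p) = T₂₁.t-short-none n (s≤s (≤-trans n≤p (m≤m+n p p))) (no-empty₂ (s≤s z≤n) n≤p)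
    inside : ∀ n → suc p ≤ n → n < suc p + p → t m 2 1 n ≡ 1
    inside n p<n n<c = T₂₁.t-short n n<c
      (BoundaryConditions-[] ≤-refl (s≤s z≤n) (λ e → ⊥-elim (<-irrefl (suc-injective e) p<n)) (λ _ _ → s≤s (<⇒≤ p<n)))
    above : ∀ q → t m 2 1 (suc p + p + q) ≡ g m q
    above q = trans (T₂₁.t-shifted q) (lastDegree-countSublists (s≤s z≤n) q)

  type22-series : ∀ c → c ≡ suc p + suc p → Tser m 2 2 ≐ X^ (suc p) ⊛ (one ⊖ X^ (suc p)) ⊛ inv1-X ⊕ X^ c ⊛ Zser m
  type22-series .(suc p + suc p) refl =
    window-series (t m 2 2) (z m) _ (suc p) (suc p + suc p) (m≤m+n (suc p) (suc p)) (shiftedGeometricPrefix-coeff (suc p) (suc p))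
                  below inside above
    where
    below : ∀ n → n < suc p → t m 2 2 n ≡ 0
    below n (s≤s n≤p) = T₂₂.t-short-none n (s≤s (≤-trans n≤p (m≤m+n p (suc p)))) (no-empty₂ (s≤s z≤n) n≤p)
    inside : ∀ n → suc p ≤ n → n < suc p + suc p → t m 2 2 n ≡ 1
    inside n p<n n<c = T₂₂.t-short n n<c
      (BoundaryConditions-[] ≤-refl ≤-refl (λ e → ⊥-elim (<-irrefl (suc-injective e) p<n)) (λ _ _ → s≤s (<⇒≤ p<n)))
    above : ∀ q → t m 2 2 (suc p + suc p + q) ≡ z m q
    above q = trans (T₂₂.t-shifted q) (z-countSublists-∧true m q)

2*[2+p]≡4+[p+p] : ∀ p → 2 * suc (suc p) ≡ 4 + (p + p)
2*[2+p]≡4+[p+p] = solve 1 (λ p → con 2 :* (con 2 :+ p) := con 4 :+ (p :+ p)) refl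
  where open import Data.Nat.Solver using (module +-*-Solver)
        open +-*-Solver

mainTheorem11 : (m : ℕ) → 2 ≤ m →
  (Tser m 0 0 ≐ Zser m)
  × (Tser m 1 0 ≐ (one ⊖ X^ (m ∸ 2)) ⊛ inv1-X ⊕ X^ (m ∸ 2) ⊛ Gser m)
  × (Tser m 1 1 ≐ X^ (m ∸ 2) ⊛ (one ⊖ X^ (m ∸ 2)) ⊛ inv1-X ⊕ X^ (2 * m ∸ 4) ⊛ Hser m)
  × (Tser m 2 0 ≐ (one ⊖ X^ (m ∸ 1)) ⊛ inv1-X ⊕ X^ (m ∸ 1) ⊛ Zser m)
  × (Tser m 2 1 ≐ X^ (m ∸ 1) ⊛ (one ⊖ X^ (m ∸ 2)) ⊛ inv1-X ⊕ X^ (2 * m ∸ 3) ⊛ Gser m)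
  × (Tser m 2 2 ≐ X^ (m ∸ 1) ⊛ (one ⊖ X^ (m ∸ 1)) ⊛ inv1-X ⊕ X^ (2 * m ∸ 2) ⊛ Zser m)
mainTheorem11 (suc (suc p)) _ =
  type00-series , type10-series ,
  type11-series (2 * m ∸ 4) (cong (_∸ 4) (2*[2+p]≡4+[p+p] p)) ,
  type20-series ,
  type21-series (2 * m ∸ 3) (cong (_∸ 3) (2*[2+p]≡4+[p+p] p)) ,
  type22-series (2 * m ∸ 2) (trans (cong (_∸ 2) (2*[2+p]≡4+[p+p] p)) (cong suc (sym (+-suc p p))))
  where open BoundaryTypes p
mainTheorem11 (suc zero) (s≤s ())
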